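{- Let $m,n$ be positive odd integers with $m>n$. Then $$S(R_{m-1,n-1})=\sum_{A\subset[n-1]}S(Y_{n-A^c})\,S(Y_A),$$ where $A^c=[n-1]\setminus A$ and $n-B=\{n-i\mid i\in B\}$.
   Context: $[k]=\{1,\dots,k\}$ and $R_{a,b}=[a]\times[b]\subset\mathbb{Z}^2$. For a finite $X\subset\mathbb{Z}^2$, a domino tiling is a set $D$ of two-element subsets of $X$, each consisting of two adjacent points (distance $1$), such that each point of $X$ lies in exactly one element of $D$; $\mathrm{D}(X)$ is the set of domino tilings. A domino $\{(i,j),(i+1,j)\}$ is horizontal and $h(D)$ is the number of horizontal dominoes. $S(X)=\sum_{D\in\mathrm{D}(X)}\sqrt{ -1}^{\,h(D)}$. Let $Y=\{(i,j)\in R_{m-1,n-1}\mid i+j<\frac{m+n}{2}\}$ and, for $A\subset[n-1]$, $Y_A=Y\cup\{(\frac{m+n}{2}-a,a)\mid a\in A\}$. -}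

module Defs where

open import Data.Bool using (Bool; true; false; _∧_; _∨_; not; if_then_else_)
open import Data.Nat using (ℕ; zero; suc; _+_; _∸_; _≤ᵇ_; _<ᵇ_; _≡ᵇ_; _%_; ⌊_/2⌋)
open import Data.Integer using (ℤ; +_; -_) renaming (_+_ to _+ℤ_; _*_ to _*ℤ_; _-_ to _-ℤ_)
open import Data.List using (List; []; _∷_; map; concatMap; foldr; upTo)
open import Data.Product using (_×_; _,_)
open import Relation.Binary.PropositionalEquality using (_≡_)

record 𝔾 : Set where
  constructor _+i_
  field
    re : ℤ
    im : ℤ
open 𝔾 public

0𝔾 : 𝔾
0𝔾 = (+ 0) +i (+ 0)

_+𝔾_ : 𝔾 → 𝔾 → 𝔾
(a +i b) +𝔾 (c +i d) = (a +ℤ c) +i (b +ℤ d)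

_*𝔾_ : 𝔾 → 𝔾 → 𝔾
(a +i b) *𝔾 (c +i d) = ((a *ℤ c) -ℤ (b *ℤ d)) +i ((a *ℤ d) +ℤ (b *ℤ c))

ι : 𝔾
ι = (+ 0) +i (+ 1)

1𝔾 : 𝔾
1𝔾 = (+ 1) +i (+ 0)

ι^ : ℕ → 𝔾
ι^ zero    = 1𝔾
ι^ (suc k) = ι *𝔾 ι^ k

sum𝔾 : List 𝔾 → 𝔾
sum𝔾 = foldr _+𝔾_ 0𝔾

-- Finite subsets of ℤ² contained in the box R_{a,b} = [a]×[b] are given
-- by a Boolean membership predicate on ℕ×ℕ (only points of the box matter).

Region : Set
Region = ℕ → ℕ → Bool

range : ℕ → List ℕ
range k = map suc (upTo k)

allB : {A : Set} → (A → Bool) → List A → Bool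
allB p = foldr (λ x r → p x ∧ r) true

-- Domino tilings, encoded as perfect matchings: every point of X records
-- the direction of its partner (the other point of its domino).
-- `none` is used exactly for points of the box not in X.

data Dir : Set where
  none right left up down : Dir

_==ᴰ_ : Dir → Dir → Bool
none  ==ᴰ none  = true
right ==ᴰ right = true
left  ==ᴰ left  = true
up    ==ᴰ up    = true
down  ==ᴰ down  = true
_     ==ᴰ _     = false

-- an assignment on the box R_{a,b}: a list of columns (index i), each a
-- list of entries (index j)
Grid : Set
Grid = List (List Dir)

nth : {A : Set} → A → List A → ℕ → A
nth d []       _       = d
nth d (x ∷ xs) zero    = x
nth d (x ∷ xs) (suc k) = nth d xs k

-- 1-based lookup; `none` outside the box (in particular at coordinate 0)
get : Grid → ℕ → ℕ → Dir
get g zero    _       = none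
get g (suc i) zero    = none
get g (suc i) (suc j) = nth none (nth [] g i) j

allLists : {A : Set} → List A → ℕ → List (List A)
allLists xs zero    = [] ∷ []
allLists xs (suc k) = concatMap (λ x → map (x ∷_) (allLists xs k)) xs

dirs : List Dir
dirs = none ∷ right ∷ left ∷ up ∷ down ∷ []

allGrids : ℕ → ℕ → List Grid
allGrids a b = allLists (allLists dirs b) a

okAt : Region → Grid → ℕ → ℕ → Bool
okAt X g i j with get g i j
... | none  = not (X i j)
... | right = X i j ∧ X (suc i) j ∧ (get g (suc i) j ==ᴰ left)
... | left  = X i j ∧ (1 <ᵇ i) ∧ X (i ∸ 1) j ∧ (get g (i ∸ 1) j ==ᴰ right)
... | up    = X i j ∧ X i (suc j) ∧ (get g i (suc j) ==ᴰ down)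
... | down  = X i j ∧ (1 <ᵇ j) ∧ X i (j ∸ 1) ∧ (get g i (j ∸ 1) ==ᴰ up)

isTiling : ℕ → ℕ → Region → Grid → Bool
isTiling a b X g = allB (λ i → allB (λ j → okAt X g i j) (range b)) (range a)

count : {A : Set} → (A → Bool) → List A → ℕ
count p = foldr (λ x r → if p x then suc r else r) 0

-- h(D): number of horizontal dominoes = number of points whose partner is to the right
hor : ℕ → ℕ → Grid → ℕ
hor a b g = foldr _+_ 0 (map (λ i → count (λ j → get g i j ==ᴰ right) (range b)) (range a))

S : ℕ → ℕ → Region → 𝔾
S a b X = sum𝔾 (map (λ g → if isTiling a b X g then ι^ (hor a b g) else 0𝔾) (allGrids a b))

inBox : ℕ → ℕ → ℕ → ℕ → Bool
inBox a b i j = (1 ≤ᵇ i) ∧ (i ≤ᵇ a) ∧ (1 ≤ᵇ j) ∧ (j ≤ᵇ b)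

Rect : ℕ → ℕ → Region
Rect a b = inBox a b

-- Y_B = Y ∪ {((m+n)/2 - a, a) | a ∈ B}, for B ⊆ [n-1] given by a predicate
-- (only a ∈ [n-1] is used), Y = {(i,j) ∈ R_{m-1,n-1} | i+j < (m+n)/2}.
YB : ℕ → ℕ → (ℕ → Bool) → Region
YB m n B i j =
  (inBox (m ∸ 1) (n ∸ 1) i j ∧ (i + j <ᵇ ⌊ m + n /2⌋))
  ∨ ((1 ≤ᵇ j) ∧ (j ≤ᵇ n ∸ 1) ∧ B j ∧ (1 ≤ᵇ i) ∧ (i + j ≡ᵇ ⌊ m + n /2⌋))

-- subsets of [k] as Boolean lists of length k; element a ∈ A iff entry a-1 is true
subsets : ℕ → List (List Bool)
subsets = allLists (true ∷ false ∷ [])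

memb : List Bool → ℕ → Bool
memb A zero    = false
memb A (suc a) = nth false A a

-- n - A^c = {n - i | i ∈ [n-1] ∖ A}: j belongs iff j ∈ [n-1] and n - j ∉ A
reflCompl : ℕ → List Bool → ℕ → Bool
reflCompl n A j = (1 ≤ᵇ j) ∧ (j ≤ᵇ n ∸ 1) ∧ not (memb A (n ∸ j))

Odd : ℕ → Set
Odd k = k % 2 ≡ 1

{-# OPTIONS --safe #-}
module Submission where

-- Cut a tiling of the rectangle along the antidiagonal i + j = h, h = (m+n)/2.  The cells
-- below it, together with those diagonal cells whose domino points left or down, form a union
-- of dominoes: this is Y_A, A being the set of rows of those diagonal cells.  The remaining
-- cells form the 180° rotation of Y_{n-A^c}.  Rotation turns right cells into left cells, and
-- a tiling has as many left cells as right cells, so the number of horizontal dominoes is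
-- additive.  Conversely, tilings of Y_{n-A^c} and Y_A glue back to a tiling of the rectangle,
-- and the weighted sum S factorises along this bijection between supports.

open import Defs
open Defs using () renaming (_+𝔾_ to infixl 6 _⊕_; _*𝔾_ to infixl 7 _⊗_)

open import Data.Bool using (Bool; true; false; T; not; _∧_; _∨_; if_then_else_)
import Data.Bool.Properties as Bool
open import Data.Bool.Properties using (T-∧; T-∨; T-≡; ∧-identityʳ; ∧-zeroʳ; ∨-inverseʳ)
open import Data.Empty using (⊥; ⊥-elim)
import Data.Integer as ℤ
import Data.Integer.Properties as ℤ
open import Data.Integer.Solver using (module +-*-Solver)
open import Data.List
  using (List; []; _∷_; map; _++_; concatMap; cartesianProductWith; cartesianProduct; length; applyUpTo
        ; applyDownFrom; upTo; reverse)
open import Data.List.Properties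
  using ( ≡-dec; map-cong; map-cong-local; map-∘; map-++; ∷-injective; length-applyUpTo; map-upTo; upTo-∷ʳ
        ; reverse-applyUpTo; reverse-map )
open import Data.List.Membership.Propositional using (_∈_)
open import Data.List.Membership.Propositional.Properties using (∈-cartesianProductWith⁺)
open import Data.List.Relation.Binary.Permutation.Propositional.Properties using (↭-reverse)
open import Data.List.Relation.Unary.All as All using (All; []; _∷_)
import Data.List.Relation.Unary.All.Properties as All
open import Data.List.Relation.Unary.AllPairs using ([]; _∷_)
open import Data.List.Relation.Unary.Any using (here; there)
open import Data.List.Relation.Unary.Unique.Propositional using (Unique)
import Data.List.Relation.Unary.Unique.Propositional.Properties as Unique
open import Data.Nat using (ℕ; zero; suc; _+_; _*_; _∸_; _≤_; _<_; s≤s; z≤n; _<ᵇ_; _≤ᵇ_; _≡ᵇ_; _%_; _/_; ⌊_/2⌋)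
open import Data.Nat.DivMod using (m≡m%n+[m/n]*n)
open import Data.Nat.ListAction using (sum)
open import Data.Nat.ListAction.Properties using (sum-++; sum-↭)
open import Data.Nat.Properties
  using ( suc-injective; +-comm; +-suc; +-identityʳ; +-cancelʳ-≡; +-cancelˡ-≤; +-mono-≤; +-mono-<; +-mono-≤-<
        ; +-monoʳ-<; m∸n≢0⇒n<m; m<n⇒0<n∸m; ∸-monoʳ-≤; m∸[m∸n]≡n; ∸-+-assoc; +-∸-assoc; m∸n+n≡m; m+n∸n≡m
        ; m∸n≤m; 1+n≰n; ≤-pred; <⇒≢; <⇒≤; <⇒≱; ≮⇒≥; ≰⇒>; <-irrefl; <-asym; <-cmp; ≤-refl; ≤-reflexive
        ; ≤-trans; ≤-<-trans; <-≤-trans; m≤m+n; m≤n⇒m≤1+n; m<n⇒m<1+n; n<1+n; m≤n⇒m<n∨m≡n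
        ; <ᵇ⇒<; <⇒<ᵇ; ≤⇒≤ᵇ; ≤ᵇ⇒≤; ≡⇒≡ᵇ; ≡ᵇ⇒≡; n≡⌊n+n/2⌋; +-commutativeSemigroup )
import Data.Nat.Solver as ℕ
open import Algebra.Properties.CommutativeSemigroup +-commutativeSemigroup
  using () renaming (interchange to +-interchange)
open import Data.Product using (_×_; _,_; proj₁; proj₂; uncurry; ∃₂)
open import Data.Product.Properties using (,-injective)
open import Data.Sum using (inj₁; inj₂; [_,_]′)
open import Data.Unit using (⊤; tt)
open import Function using (_∘_; id; Equivalence)
open import Relation.Binary.Definitions using (DecidableEquality; tri<; tri≈; tri>)
open import Relation.Binary.PropositionalEquality
open import Relation.Binary.PropositionalEquality.Properties using (setoid)
open import Relation.Nullary using (yes; no; does; ¬_; _×-dec_)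
open import Relation.Nullary.Decidable using (T?; map′)
open import Relation.Unary using (U)

open ≡-Reasoning

T⇒≡true : ∀ {b} → T b → b ≡ true
T⇒≡true = Equivalence.to T-≡

¬T⇒≡false : ∀ {b} → ¬ T b → b ≡ false
¬T⇒≡false {true}  ¬b = ⊥-elim (¬b tt)
¬T⇒≡false {false} _  = refl

T-not⁺ : ∀ {b} → ¬ T b → T (not b)
T-not⁺ {true}  ¬b = ¬b tt
T-not⁺ {false} _  = tt

T-not⁻ : ∀ {b} → T (not b) → ¬ T b
T-not⁻ {false} _ ()

¬T-not⇒T : ∀ {b} → ¬ T (not b) → T b
¬T-not⇒T {true}  _  = tt
¬T-not⇒T {false} ¬t = ¬t tt

∧-split : ∀ {x y} → T (x ∧ y) → T x × T y
∧-split = Equivalence.to T-∧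

∧-join : ∀ {x y} → T x → T y → T (x ∧ y)
∧-join x y = Equivalence.from T-∧ (x , y)

∧-split′ : ∀ {x y z} → T (x ∧ y ∧ z) → T x × T y × T z
∧-split′ p = let (x , yz) = ∧-split p in x , ∧-split yz

∧-split″ : ∀ {w x y z} → T (w ∧ x ∧ y ∧ z) → T w × T x × T y × T z
∧-split″ p = let (w , xyz) = ∧-split p in w , ∧-split′ xyz

≤ᵇ-true : ∀ {m n} → m ≤ n → (m ≤ᵇ n) ≡ true
≤ᵇ-true = T⇒≡true ∘ ≤⇒≤ᵇ

-- Gaussian integers

𝔾-ext : ∀ {a b c d} → a ≡ c → b ≡ d → a +i b ≡ c +i d
𝔾-ext refl refl = refl

⊕-assoc : ∀ x y z → (x ⊕ y) ⊕ z ≡ x ⊕ (y ⊕ z)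
⊕-assoc (a +i b) (c +i d) (e +i f) = 𝔾-ext (ℤ.+-assoc a c e) (ℤ.+-assoc b d f)

⊕-comm : ∀ x y → x ⊕ y ≡ y ⊕ x
⊕-comm (a +i b) (c +i d) = 𝔾-ext (ℤ.+-comm a c) (ℤ.+-comm b d)

⊕-identityˡ : ∀ x → 0𝔾 ⊕ x ≡ x
⊕-identityˡ (a +i b) = 𝔾-ext (ℤ.+-identityˡ a) (ℤ.+-identityˡ b)

⊕-identityʳ : ∀ x → x ⊕ 0𝔾 ≡ x
⊕-identityʳ (a +i b) = 𝔾-ext (ℤ.+-identityʳ a) (ℤ.+-identityʳ b)

⊕-interchange : ∀ w x y z → (w ⊕ x) ⊕ (y ⊕ z) ≡ (w ⊕ y) ⊕ (x ⊕ z)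
⊕-interchange w x y z = begin
  (w ⊕ x) ⊕ (y ⊕ z)  ≡⟨ ⊕-assoc w x (y ⊕ z) ⟩
  w ⊕ (x ⊕ (y ⊕ z))  ≡⟨ cong (w ⊕_) (sym (⊕-assoc x y z)) ⟩
  w ⊕ ((x ⊕ y) ⊕ z)  ≡⟨ cong (λ u → w ⊕ (u ⊕ z)) (⊕-comm x y) ⟩
  w ⊕ ((y ⊕ x) ⊕ z)  ≡⟨ cong (w ⊕_) (⊕-assoc y x z) ⟩
  w ⊕ (y ⊕ (x ⊕ z))  ≡⟨ sym (⊕-assoc w y (x ⊕ z)) ⟩
  (w ⊕ y) ⊕ (x ⊕ z)  ∎

module _ where
  open +-*-Solver

  ⊗-assoc : ∀ x y z → (x ⊗ y) ⊗ z ≡ x ⊗ (y ⊗ z)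
  ⊗-assoc (a +i b) (c +i d) (e +i f) = 𝔾-ext
    (solve 6 (λ a b c d e f → ((a :* c) :- (b :* d)) :* e :- ((a :* d) :+ (b :* c)) :* f
                            := a :* ((c :* e) :- (d :* f)) :- b :* ((c :* f) :+ (d :* e))) refl a b c d e f)
    (solve 6 (λ a b c d e f → ((a :* c) :- (b :* d)) :* f :+ ((a :* d) :+ (b :* c)) :* e
                            := a :* ((c :* f) :+ (d :* e)) :+ b :* ((c :* e) :- (d :* f))) refl a b c d e f)

  ⊗-comm : ∀ x y → x ⊗ y ≡ y ⊗ x
  ⊗-comm (a +i b) (c +i d) = 𝔾-ext
    (solve 4 (λ a b c d → (a :* c) :- (b :* d) := (c :* a) :- (d :* b)) refl a b c d)
    (solve 4 (λ a b c d → (a :* d) :+ (b :* c) := (c :* b) :+ (d :* a)) refl a b c d)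

  ⊗-distribˡ-⊕ : ∀ x y z → x ⊗ (y ⊕ z) ≡ x ⊗ y ⊕ x ⊗ z
  ⊗-distribˡ-⊕ (a +i b) (c +i d) (e +i f) = 𝔾-ext
    (solve 6 (λ a b c d e f → (a :* (c :+ e)) :- (b :* (d :+ f))
                            := ((a :* c) :- (b :* d)) :+ ((a :* e) :- (b :* f))) refl a b c d e f)
    (solve 6 (λ a b c d e f → (a :* (d :+ f)) :+ (b :* (c :+ e))
                            := ((a :* d) :+ (b :* c)) :+ ((a :* f) :+ (b :* e))) refl a b c d e f)

  ⊗-zeroʳ : ∀ x → x ⊗ 0𝔾 ≡ 0𝔾
  ⊗-zeroʳ (a +i b) = 𝔾-ext
    (solve 2 (λ a b → (a :* con (ℤ.+ 0)) :- (b :* con (ℤ.+ 0)) := con (ℤ.+ 0)) refl a b)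
    (solve 2 (λ a b → (a :* con (ℤ.+ 0)) :+ (b :* con (ℤ.+ 0)) := con (ℤ.+ 0)) refl a b)

  ⊗-identityˡ : ∀ x → 1𝔾 ⊗ x ≡ x
  ⊗-identityˡ (a +i b) = 𝔾-ext
    (solve 2 (λ a b → (con (ℤ.+ 1) :* a) :- (con (ℤ.+ 0) :* b) := a) refl a b)
    (solve 2 (λ a b → (con (ℤ.+ 1) :* b) :+ (con (ℤ.+ 0) :* a) := b) refl a b)

⊗-distribʳ-⊕ : ∀ x y z → (y ⊕ z) ⊗ x ≡ y ⊗ x ⊕ z ⊗ x
⊗-distribʳ-⊕ x y z = begin
  (y ⊕ z) ⊗ x       ≡⟨ ⊗-comm (y ⊕ z) x ⟩
  x ⊗ (y ⊕ z)       ≡⟨ ⊗-distribˡ-⊕ x y z ⟩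
  x ⊗ y ⊕ x ⊗ z    ≡⟨ cong₂ _⊕_ (⊗-comm x y) (⊗-comm x z) ⟩
  y ⊗ x ⊕ z ⊗ x    ∎

⊗-zeroˡ : ∀ x → 0𝔾 ⊗ x ≡ 0𝔾
⊗-zeroˡ x = trans (⊗-comm 0𝔾 x) (⊗-zeroʳ x)

ι^-+ : ∀ p q → ι^ (p + q) ≡ ι^ p ⊗ ι^ q
ι^-+ zero    q = sym (⊗-identityˡ (ι^ q))
ι^-+ (suc p) q = trans (cong (ι ⊗_) (ι^-+ p q)) (sym (⊗-assoc ι (ι^ p) (ι^ q)))

-- Finite sums

∑ : {A : Set} → List A → (A → 𝔾) → 𝔾
∑ xs f = sum𝔾 (map f xs)

∑-cong : {A : Set} (xs : List A) {f g : A → 𝔾} → (∀ x → f x ≡ g x) → ∑ xs f ≡ ∑ xs g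
∑-cong xs f≗g = cong sum𝔾 (map-cong f≗g xs)

∑-cong-All : {A : Set} {P : A → Set} {xs : List A} {f g : A → 𝔾} →
             All P xs → (∀ x → P x → f x ≡ g x) → ∑ xs f ≡ ∑ xs g
∑-cong-All []       _   = refl
∑-cong-All (p ∷ ps) f≗g = cong₂ _⊕_ (f≗g _ p) (∑-cong-All ps f≗g)

∑-map : {A B : Set} (g : A → B) (xs : List A) (f : B → 𝔾) → ∑ (map g xs) f ≡ ∑ xs (f ∘ g)
∑-map g xs f = cong sum𝔾 (sym (map-∘ xs))

∑-++ : {A : Set} (xs ys : List A) (f : A → 𝔾) → ∑ (xs ++ ys) f ≡ ∑ xs f ⊕ ∑ ys f
∑-++ []       ys f = sym (⊕-identityˡ _)
∑-++ (x ∷ xs) ys f = trans (cong (f x ⊕_) (∑-++ xs ys f)) (sym (⊕-assoc (f x) _ _))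

∑-zero : {A : Set} (xs : List A) → ∑ xs (λ _ → 0𝔾) ≡ 0𝔾
∑-zero []       = refl
∑-zero (x ∷ xs) = trans (⊕-identityˡ _) (∑-zero xs)

∑-⊕ : {A : Set} (xs : List A) (f g : A → 𝔾) → ∑ xs (λ x → f x ⊕ g x) ≡ ∑ xs f ⊕ ∑ xs g
∑-⊕ []       f g = sym (⊕-identityˡ 0𝔾)
∑-⊕ (x ∷ xs) f g = trans (cong (f x ⊕ g x ⊕_) (∑-⊕ xs f g)) (⊕-interchange (f x) (g x) _ _)

∑-comm : {A B : Set} (xs : List A) (ys : List B) (f : A → B → 𝔾) →
         ∑ xs (λ x → ∑ ys (f x)) ≡ ∑ ys (λ y → ∑ xs (λ x → f x y))
∑-comm []       ys f = sym (∑-zero ys)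
∑-comm (x ∷ xs) ys f =
  trans (cong (∑ ys (f x) ⊕_) (∑-comm xs ys f)) (sym (∑-⊕ ys (f x) (λ y → ∑ xs (λ x → f x y))))

∑-⊗ˡ : {A : Set} (c : 𝔾) (xs : List A) (f : A → 𝔾) → c ⊗ ∑ xs f ≡ ∑ xs (λ x → c ⊗ f x)
∑-⊗ˡ c []       f = ⊗-zeroʳ c
∑-⊗ˡ c (x ∷ xs) f = trans (⊗-distribˡ-⊕ c (f x) _) (cong (c ⊗ f x ⊕_) (∑-⊗ˡ c xs f))

∑-⊗ʳ : {A : Set} (c : 𝔾) (xs : List A) (f : A → 𝔾) → ∑ xs f ⊗ c ≡ ∑ xs (λ x → f x ⊗ c)
∑-⊗ʳ c []       f = ⊗-zeroˡ c
∑-⊗ʳ c (x ∷ xs) f = trans (⊗-distribʳ-⊕ c (f x) _) (cong (f x ⊗ c ⊕_) (∑-⊗ʳ c xs f))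

∑-product : {A B : Set} (xs : List A) (ys : List B) (f : A → 𝔾) (g : B → 𝔾) →
            ∑ xs f ⊗ ∑ ys g ≡ ∑ xs (λ x → ∑ ys (λ y → f x ⊗ g y))
∑-product xs ys f g = trans (∑-⊗ʳ (∑ ys g) xs f) (∑-cong xs (λ x → ∑-⊗ˡ (f x) ys g))

∑-cartesianProductWith : {A B C : Set} (_∙_ : A → B → C) (xs : List A) (ys : List B) (f : C → 𝔾) →
                         ∑ (cartesianProductWith _∙_ xs ys) f ≡ ∑ xs (λ x → ∑ ys (λ y → f (x ∙ y)))
∑-cartesianProductWith _∙_ []       ys f = refl
∑-cartesianProductWith _∙_ (x ∷ xs) ys f = begin
  ∑ (map (x ∙_) ys ++ cartesianProductWith _∙_ xs ys) f
    ≡⟨ ∑-++ (map (x ∙_) ys) _ f ⟩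
  ∑ (map (x ∙_) ys) f ⊕ ∑ (cartesianProductWith _∙_ xs ys) f
    ≡⟨ cong₂ _⊕_ (∑-map (x ∙_) ys f) (∑-cartesianProductWith _∙_ xs ys f) ⟩
  ∑ ys (λ y → f (x ∙ y)) ⊕ ∑ xs (λ x → ∑ ys (λ y → f (x ∙ y)))  ∎

when : Bool → 𝔾 → 𝔾
when b c = if b then c else 0𝔾

when-vanishes : ∀ b {c} → c ≡ 0𝔾 → when b c ≡ 0𝔾
when-vanishes true  c≡0 = c≡0
when-vanishes false _   = refl

pointMass : {A : Set} → DecidableEquality A → A → 𝔾 → A → 𝔾
pointMass _≟_ y c x = when (does (x ≟ y)) c

module _ {A : Set} (_≟_ : DecidableEquality A) where

  pointMass-self : ∀ y c → pointMass _≟_ y c y ≡ c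
  pointMass-self y c with y ≟ y
  ... | yes _   = refl
  ... | no y≢y = ⊥-elim (y≢y refl)

  pointMass-≢ : ∀ {x y} c → x ≢ y → pointMass _≟_ y c x ≡ 0𝔾
  pointMass-≢ {x} {y} c x≢y with x ≟ y
  ... | yes x≡y = ⊥-elim (x≢y x≡y)
  ... | no _    = refl

  ∑-pointMass-∉ : ∀ {y} {xs : List A} c → All (_≢ y) xs → ∑ xs (pointMass _≟_ y c) ≡ 0𝔾
  ∑-pointMass-∉ {xs = xs} c xs≢y = trans (∑-cong-All xs≢y (λ x → pointMass-≢ c)) (∑-zero xs)

  ∑-pointMass : ∀ {y} {xs : List A} c → Unique xs → y ∈ xs → ∑ xs (pointMass _≟_ y c) ≡ c
  ∑-pointMass c (x≢xs ∷ _) (here refl) =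
    trans (cong₂ _⊕_ (pointMass-self _ c) (∑-pointMass-∉ c (All.map (_∘ sym) x≢xs))) (⊕-identityʳ c)
  ∑-pointMass c (x≢xs ∷ u) (there y∈xs) =
    trans (cong₂ _⊕_ (pointMass-≢ c (λ x≡y → All.lookup x≢xs y∈xs x≡y)) (∑-pointMass c u y∈xs)) (⊕-identityˡ c)

-- Enumerations and reindexing

record Enumeration {A : Set} (P : A → Set) (xs : List A) : Set where
  field
    sound    : All P xs
    complete : ∀ {y} → P y → y ∈ xs
    unique   : Unique xs

enumeration-cartesianProductWith :
  {A B C : Set} {P : A → Set} {Q : B → Set} {R : C → Set} {xs : List A} {ys : List B}
  (_∙_ : A → B → C) → (∀ {w x y z} → w ∙ y ≡ x ∙ z → w ≡ x × y ≡ z) →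
  (∀ {x y} → P x → Q y → R (x ∙ y)) → (∀ {z} → R z → ∃₂ λ x y → P x × Q y × x ∙ y ≡ z) →
  Enumeration P xs → Enumeration Q ys → Enumeration R (cartesianProductWith _∙_ xs ys)
enumeration-cartesianProductWith {xs = xs} {ys} _∙_ ∙-injective R-intro R-elim exs eys = record
  { sound    = All.cartesianProductWith⁺ (setoid _) (setoid _) _∙_ xs ys
                 (λ x∈ y∈ → R-intro (All.lookup (sound exs) x∈) (All.lookup (sound eys) y∈))
  ; complete = λ r → let (x , y , p , q , x∙y≡z) = R-elim r in
                 subst (_∈ _) x∙y≡z (∈-cartesianProductWith⁺ _∙_ (complete exs p) (complete eys q))
  ; unique   = Unique.cartesianProductWith⁺ _∙_ ∙-injective (unique exs) (unique eys)
  }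
  where open Enumeration

enumeration-cartesianProduct :
  {A B : Set} {P : A → Set} {Q : B → Set} {xs : List A} {ys : List B} →
  Enumeration P xs → Enumeration Q ys → Enumeration (λ (x , y) → P x × Q y) (cartesianProduct xs ys)
enumeration-cartesianProduct =
  enumeration-cartesianProductWith _,_ ,-injective _,_ (λ (p , q) → _ , _ , p , q , refl)

ListOf : {A : Set} → ℕ → (A → Set) → List A → Set
ListOf k P v = length v ≡ k × All P v

concatMap-prepend : {A : Set} (xs : List A) (vs : List (List A)) →
                    concatMap (λ x → map (x ∷_) vs) xs ≡ cartesianProductWith _∷_ xs vs
concatMap-prepend []       vs = refl
concatMap-prepend (x ∷ xs) vs = cong (map (x ∷_) vs ++_) (concatMap-prepend xs vs)

enumeration-allLists : {A : Set} {P : A → Set} {xs : List A} →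
                       Enumeration P xs → ∀ k → Enumeration (ListOf k P) (allLists xs k)
enumeration-allLists exs zero = record
  { sound    = (refl , []) ∷ []
  ; complete = λ { {[]} _ → here refl }
  ; unique   = [] ∷ []
  }
enumeration-allLists {xs = xs} exs (suc k) =
  subst (Enumeration (ListOf (suc k) _)) (sym (concatMap-prepend xs (allLists xs k)))
    (enumeration-cartesianProductWith _∷_ ∷-injective
      (λ p (len , ps) → cong suc len , p ∷ ps)
      (λ { {y ∷ w} (len , p ∷ ps) → y , w , p , (suc-injective len , ps) , refl })
      exs (enumeration-allLists exs k))

dirs-complete : ∀ {d} → U d → d ∈ dirs
dirs-complete {none}  _ = here refl
dirs-complete {right} _ = there (here refl)
dirs-complete {left}  _ = there (there (here refl))
dirs-complete {up}    _ = there (there (there (here refl)))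
dirs-complete {down}  _ = there (there (there (there (here refl))))

dirs-enumeration : Enumeration U dirs
dirs-enumeration = record
  { sound    = tt ∷ tt ∷ tt ∷ tt ∷ tt ∷ []
  ; complete = dirs-complete
  ; unique   = ((λ ()) ∷ (λ ()) ∷ (λ ()) ∷ (λ ()) ∷ []) ∷ ((λ ()) ∷ (λ ()) ∷ (λ ()) ∷ [])
               ∷ ((λ ()) ∷ (λ ()) ∷ []) ∷ ((λ ()) ∷ []) ∷ [] ∷ []
  }

bools-complete : ∀ {x} → U x → x ∈ true ∷ false ∷ []
bools-complete {true}  _ = here refl
bools-complete {false} _ = there (here refl)

bools-enumeration : Enumeration U (true ∷ false ∷ [])
bools-enumeration = record
  { sound    = tt ∷ tt ∷ []
  ; complete = bools-complete
  ; unique   = ((λ ()) ∷ []) ∷ [] ∷ []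
  }

==ᴰ⇒≡ : ∀ x y → T (x ==ᴰ y) → x ≡ y
==ᴰ⇒≡ none  none  _ = refl
==ᴰ⇒≡ right right _ = refl
==ᴰ⇒≡ left  left  _ = refl
==ᴰ⇒≡ up    up    _ = refl
==ᴰ⇒≡ down  down  _ = refl

==ᴰ-refl : ∀ x → T (x ==ᴰ x)
==ᴰ-refl none  = tt
==ᴰ-refl right = tt
==ᴰ-refl left  = tt
==ᴰ-refl up    = tt
==ᴰ-refl down  = tt

_≟ᴰ_ : DecidableEquality Dir
x ≟ᴰ y = map′ (==ᴰ⇒≡ x y) (λ { refl → ==ᴰ-refl x }) (T? (x ==ᴰ y))

≡⇒==ᴰ : ∀ {x y} → x ≡ y → T (x ==ᴰ y)
≡⇒==ᴰ {x} refl = ==ᴰ-refl x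

×-≡-dec : {A B : Set} → DecidableEquality A → DecidableEquality B → DecidableEquality (A × B)
×-≡-dec _≟₁_ _≟₂_ (x , y) (x' , y') = map′ (uncurry (cong₂ _,_)) ,-injective (x ≟₁ x' ×-dec y ≟₂ y')

_≟ᴳ_ : DecidableEquality Grid
_≟ᴳ_ = ≡-dec (≡-dec _≟ᴰ_)

record SupportBijection {X Y : Set} (P : X → Set) (Q : Y → Set) (f : X → 𝔾) (g : Y → 𝔾) : Set where
  field
    to         : X → Y
    from       : Y → X
    suppˣ      : X → Bool
    suppʸ      : Y → Bool
    f-outside  : ∀ x → ¬ T (suppˣ x) → f x ≡ 0𝔾
    g-outside  : ∀ y → ¬ T (suppʸ y) → g y ≡ 0𝔾
    to-shape   : ∀ x → P x → T (suppˣ x) → Q (to x)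
    to-supp    : ∀ x → P x → T (suppˣ x) → T (suppʸ (to x))
    from-to    : ∀ x → P x → T (suppˣ x) → from (to x) ≡ x
    from-shape : ∀ y → Q y → T (suppʸ y) → P (from y)
    from-supp  : ∀ y → Q y → T (suppʸ y) → T (suppˣ (from y))
    to-from    : ∀ y → Q y → T (suppʸ y) → to (from y) ≡ y
    f-from     : ∀ y → Q y → T (suppʸ y) → f (from y) ≡ g y

∑-spread : {X Y : Set} {P : X → Set} {Q : Y → Set} {ys : List Y} (_≟_ : DecidableEquality Y) →
           Enumeration Q ys → (to : X → Y) (supp : X → Bool) (f : X → 𝔾) → (∀ x → ¬ T (supp x) → f x ≡ 0𝔾) →
           (∀ x → P x → T (supp x) → Q (to x)) → ∀ x → P x → f x ≡ ∑ ys (pointMass _≟_ (to x) (f x))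
∑-spread {ys = ys} _≟_ eys to supp f f-outside Q-to x px with T? (supp x)
... | yes s = sym (∑-pointMass _≟_ (f x) (Enumeration.unique eys) (Enumeration.complete eys (Q-to x px s)))
... | no ¬s rewrite f-outside x ¬s = sym (trans (∑-cong ys (λ y → when-vanishes _ refl)) (∑-zero ys))

-- Both sums equal the double sum of the kernel [y = to x] f x = [x = from y] g y.
module _ {X Y : Set} (_≟ˣ_ : DecidableEquality X) (_≟ʸ_ : DecidableEquality Y) where

  ∑-reindex : {P : X → Set} {Q : Y → Set} {xs : List X} {ys : List Y} {f : X → 𝔾} {g : Y → 𝔾} →
              Enumeration P xs → Enumeration Q ys → SupportBijection P Q f g → ∑ xs f ≡ ∑ ys g
  ∑-reindex {P} {Q} {xs} {ys} {f} {g} exs eys bij = begin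
    ∑ xs f
      ≡⟨ ∑-cong-All (sound exs) (∑-spread _≟ʸ_ eys to suppˣ f f-outside to-shape) ⟩
    ∑ xs (λ x → ∑ ys (pointMass _≟ʸ_ (to x) (f x)))
      ≡⟨ ∑-comm xs ys _ ⟩
    ∑ ys (λ y → ∑ xs (λ x → pointMass _≟ʸ_ (to x) (f x) y))
      ≡⟨ ∑-cong-All (sound eys) (λ y qy → ∑-cong-All (sound exs) (λ x px → kernel px qy)) ⟩
    ∑ ys (λ y → ∑ xs (pointMass _≟ˣ_ (from y) (g y)))
      ≡⟨ sym (∑-cong-All (sound eys) (∑-spread _≟ˣ_ exs from suppʸ g g-outside from-shape)) ⟩
    ∑ ys g ∎
    where
    open Enumeration
    open SupportBijection bij

    kernel : ∀ {x y} → P x → Q y → pointMass _≟ʸ_ (to x) (f x) y ≡ pointMass _≟ˣ_ (from y) (g y) x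
    kernel {x} {y} px qy with T? (suppˣ x) | T? (suppʸ y)
    ... | no ¬sx | no ¬sy = trans (when-vanishes _ (f-outside x ¬sx)) (sym (when-vanishes _ (g-outside y ¬sy)))
    ... | yes sx | no ¬sy =
      trans (pointMass-≢ _≟ʸ_ (f x) (λ { refl → ¬sy (to-supp x px sx) })) (sym (when-vanishes _ (g-outside y ¬sy)))
    ... | no ¬sx | yes sy =
      trans (when-vanishes _ (f-outside x ¬sx)) (sym (pointMass-≢ _≟ˣ_ (g y) (λ { refl → ¬sx (from-supp y qy sy) })))
    ... | yes sx | yes sy with y ≟ʸ to x | x ≟ˣ from y
    ...   | yes y≡tx | yes x≡fy = trans (cong f x≡fy) (f-from y qy sy)
    ...   | no _     | no _     = refl
    ...   | yes y≡tx | no x≢fy  = ⊥-elim (x≢fy (trans (sym (from-to x px sx)) (cong from (sym y≡tx))))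
    ...   | no y≢tx  | yes x≡fy = ⊥-elim (y≢tx (trans (sym (to-from y qy sy)) (cong to (sym x≡fy))))

-- Tilings as pairings

Pairing : Set
Pairing = ℕ → ℕ → Dir

opp : Dir → Dir
opp none  = none
opp right = left
opp left  = right
opp up    = down
opp down  = up

opp-involutive : ∀ d → opp (opp d) ≡ d
opp-involutive none  = refl
opp-involutive right = refl
opp-involutive left  = refl
opp-involutive up    = refl
opp-involutive down  = refl

shiftˣ : Dir → ℕ → ℕ
shiftˣ right i = suc i
shiftˣ left  i = i ∸ 1
shiftˣ _     i = i

shiftʸ : Dir → ℕ → ℕ
shiftʸ up   j = suc j
shiftʸ down j = j ∸ 1
shiftʸ _    j = j

-- A genuine direction whose step from (i, j) stays among positive coordinates (no truncation in ∸).
Valid : Dir → ℕ → ℕ → Set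
Valid none i j = ⊥
Valid left i j = 1 < i
Valid down i j = 1 < j
Valid _    i j = ⊤

-- Fits X (get g) i j (get g i j) is the condition okAt X g i j of Defs.
data Fits (X : Region) (G : Pairing) (i j : ℕ) : Dir → Set where
  vacant : ¬ T (X i j) → Fits X G i j none
  domino : ∀ {d} → Valid d i j → T (X i j) → T (X (shiftˣ d i) (shiftʸ d j)) →
           G (shiftˣ d i) (shiftʸ d j) ≡ opp d → Fits X G i j d

shiftˣ-opp : ∀ d {i j} → Valid d i j → shiftˣ (opp d) (shiftˣ d i) ≡ i
shiftˣ-opp right         _         = refl
shiftˣ-opp left  {suc i} (s≤s 1≤i) = refl
shiftˣ-opp up            _         = refl
shiftˣ-opp down          _         = refl

shiftʸ-opp : ∀ d {i j} → Valid d i j → shiftʸ (opp d) (shiftʸ d j) ≡ j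
shiftʸ-opp right         _         = refl
shiftʸ-opp left          _         = refl
shiftʸ-opp up            _         = refl
shiftʸ-opp down  {j = suc j} (s≤s _) = refl

_∪_ : Region → Region → Region
(X ∪ Y) i j = X i j ∨ Y i j

_∖_ : Region → Region → Region
(X ∖ Z) i j = X i j ∧ not (Z i j)

merge : Region → Pairing → Pairing → Pairing
merge Z G H i j = if Z i j then G i j else H i j

restrict : Region → Pairing → Pairing
restrict Z G = merge Z G (λ _ _ → none)

module _ (Z : Region) (G H : Pairing) {i j : ℕ} where

  merge-in : T (Z i j) → merge Z G H i j ≡ G i j
  merge-in z with Z i j
  ... | true = refl

  merge-out : ¬ T (Z i j) → merge Z G H i j ≡ H i j
  merge-out ∉Z with Z i j
  ... | true  = ⊥-elim (∉Z tt)
  ... | false = refl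

module _ (X Y : Region) {i j : ℕ} where

  ∪-inˡ : T (X i j) → T ((X ∪ Y) i j)
  ∪-inˡ x = Equivalence.from T-∨ (inj₁ x)

  ∪-inʳ : T (Y i j) → T ((X ∪ Y) i j)
  ∪-inʳ y = Equivalence.from T-∨ (inj₂ y)

  ∪-out : ¬ T (X i j) → ¬ T (Y i j) → ¬ T ((X ∪ Y) i j)
  ∪-out ∉X ∉Y xy = [ ∉X , ∉Y ]′ (Equivalence.to T-∨ xy)

  ∖-in : T (X i j) → ¬ T (Y i j) → T ((X ∖ Y) i j)
  ∖-in x ∉Y = ∧-join x (T-not⁺ ∉Y)

  ∖-⊆ : T ((X ∖ Y) i j) → T (X i j)
  ∖-⊆ = proj₁ ∘ ∧-split

  ∖-out : T ((X ∖ Y) i j) → ¬ T (Y i j)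
  ∖-out = T-not⁻ ∘ proj₂ ∘ ∧-split

record InBox (a b i j : ℕ) : Set where
  constructor box
  field
    1≤i : 1 ≤ i
    i≤a : i ≤ a
    1≤j : 1 ≤ j
    j≤b : j ≤ b

module _ (a b : ℕ) where

  Within : Region → Set
  Within X = ∀ {i j} → T (X i j) → InBox a b i j

  Tiles : Region → Pairing → Set
  Tiles X G = ∀ {i j} → InBox a b i j → Fits X G i j (G i j)

  Closed : Region → Pairing → Set
  Closed Z G = ∀ {i j} → InBox a b i j → T (Z i j) → T (Z (shiftˣ (G i j) i) (shiftʸ (G i j) j))

  Tiles-cong : ∀ {X X' G G'} → Within X → (∀ {i j} → InBox a b i j → X' i j ≡ X i j) →
               (∀ {i j} → InBox a b i j → G' i j ≡ G i j) → Tiles X G → Tiles X' G'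
  Tiles-cong {X} {X'} {G} {G'} within X'≡X G'≡G tX {i} {j} c =
    subst (Fits X' G' i j) (sym (G'≡G c)) (transport (tX c))
    where
    transport : ∀ {d} → Fits X G i j d → Fits X' G' i j d
    transport (vacant ∉X)        = vacant (∉X ∘ subst T (X'≡X c))
    transport (domino v x x' g) =
      domino v (subst T (sym (X'≡X c)) x) (subst T (sym (X'≡X (within x'))) x') (trans (G'≡G (within x')) g)

  Tiles-∪ : ∀ {X Y G H} → Tiles X G → Tiles Y H → (∀ {i j} → T (X i j) → ¬ T (Y i j)) →
            Tiles (X ∪ Y) (merge X G H)
  Tiles-∪ {X} {Y} {G} {H} tX tY disjoint {i} {j} c with T? (X i j)
  ... | yes x = subst (Fits _ _ i j) (sym (merge-in X G H x)) (fromX (tX c))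
    where
    fromX : ∀ {d} → Fits X G i j d → Fits (X ∪ Y) (merge X G H) i j d
    fromX (vacant ∉X)        = ⊥-elim (∉X x)
    fromX (domino v _ x' g) = domino v (∪-inˡ X Y x) (∪-inˡ X Y x') (trans (merge-in X G H x') g)
  ... | no ∉X = subst (Fits _ _ i j) (sym (merge-out X G H ∉X)) (fromY (tY c))
    where
    fromY : ∀ {d} → Fits Y H i j d → Fits (X ∪ Y) (merge X G H) i j d
    fromY (vacant ∉Y)        = vacant (∪-out X Y ∉X ∉Y)
    fromY (domino v y y' h) = domino v (∪-inʳ X Y y) (∪-inʳ X Y y') (trans (merge-out X G H (λ x' → disjoint x' y')) h)

  Tiles-restrict : ∀ {X Z G} → Tiles X G → (∀ {i j} → T (Z i j) → T (X i j)) → Closed Z G →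
                   Tiles Z (restrict Z G)
  Tiles-restrict {X} {Z} {G} tX Z⊆X closed {i} {j} c with T? (Z i j)
  ... | no ∉Z = subst (Fits _ _ i j) (sym (merge-out Z G (λ _ _ → none) ∉Z)) (vacant ∉Z)
  ... | yes z = subst (Fits _ _ i j) (sym (merge-in Z G (λ _ _ → none) z)) (restrictFits (tX c) (closed c z))
    where
    restrictFits : ∀ {d} → Fits X G i j d → T (Z (shiftˣ d i) (shiftʸ d j)) → Fits Z (restrict Z G) i j d
    restrictFits (vacant ∉X)        _  = ⊥-elim (∉X (Z⊆X z))
    restrictFits (domino v _ _ g) z' = domino v z z' (trans (merge-in Z G (λ _ _ → none) z') g)

  Closed-∖ : ∀ {X Z G} → Within X → Tiles X G → Closed Z G → Closed (X ∖ Z) G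
  Closed-∖ {X} {Z} {G} within tX closed {i} {j} c xz = partner∈X∖Z (tX c)
    where
    partner∈X∖Z : ∀ {d} → Fits X G i j d → T ((X ∖ Z) (shiftˣ d i) (shiftʸ d j))
    partner∈X∖Z (vacant _)                = xz
    partner∈X∖Z {d} (domino v _ x' g) = ∖-in X Z x' λ z' →
      ∖-out X Z xz (subst₂ (λ k l → T (Z k l)) (shiftˣ-opp d v) (shiftʸ-opp d v)
                 (subst (λ e → T (Z (shiftˣ e _) (shiftʸ e _))) g (closed (within x') z')))

  vacant⇒none : ∀ {X G i j} → Tiles X G → InBox a b i j → ¬ T (X i j) → G i j ≡ none
  vacant⇒none {X} {G} {i} {j} tX c ∉X = none-of (tX c)
    where
    none-of : ∀ {d} → Fits X G i j d → d ≡ none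
    none-of (vacant _)          = refl
    none-of (domino _ x _ _) = ⊥-elim (∉X x)

reflect : ℕ → ℕ → ℕ
reflect a i = suc a ∸ i

module _ {a : ℕ} where

  reflect-∈ : ∀ {i} → 1 ≤ i → i ≤ a → 1 ≤ reflect a i × reflect a i ≤ a
  reflect-∈ {i} 1≤i i≤a = m<n⇒0<n∸m (s≤s i≤a) , ∸-monoʳ-≤ (suc a) 1≤i

  reflect-∈⁻ : ∀ {i} → 1 ≤ reflect a i → reflect a i ≤ a → 1 ≤ i × i ≤ a
  reflect-∈⁻ {zero}  _ ρi≤a = ⊥-elim (1+n≰n ρi≤a)
  reflect-∈⁻ {suc i} ρi≥1 _ = s≤s z≤n , ≤-pred (m∸n≢0⇒n<m (λ ρi≡0 → <⇒≢ ρi≥1 (sym ρi≡0)))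

  reflect-involutive : ∀ {i} → i ≤ suc a → reflect a (reflect a i) ≡ i
  reflect-involutive = m∸[m∸n]≡n

  reflect-suc : ∀ i → reflect a (suc i) ≡ reflect a i ∸ 1
  reflect-suc i = trans (cong (suc a ∸_) (+-comm 1 i)) (sym (∸-+-assoc (suc a) i 1))

  reflect-pred : ∀ {i} → 1 < i → i ≤ suc a → reflect a (i ∸ 1) ≡ suc (reflect a i)
  reflect-pred {suc i} _ (s≤s i≤a) = +-∸-assoc 1 i≤a

  reflect-edge : ∀ {i} → 1 ≤ i → suc (reflect a i) ≤ a → 1 < i
  reflect-edge {suc zero}    _ a<a = ⊥-elim (1+n≰n a<a)
  reflect-edge {suc (suc i)} _ _   = s≤s (s≤s z≤n)

module _ (a b : ℕ) where

  rotateRegion : Region → Region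
  rotateRegion X i j = X (reflect a i) (reflect b j)

  rotatePairing : Pairing → Pairing
  rotatePairing G i j = opp (G (reflect a i) (reflect b j))

  reflect-box : ∀ {i j} → InBox a b i j → InBox a b (reflect a i) (reflect b j)
  reflect-box (box 1≤i i≤a 1≤j j≤b) =
    box (proj₁ (reflect-∈ 1≤i i≤a)) (proj₂ (reflect-∈ 1≤i i≤a))
        (proj₁ (reflect-∈ 1≤j j≤b)) (proj₂ (reflect-∈ 1≤j j≤b))

  reflect-box⁻ : ∀ {i j} → InBox a b (reflect a i) (reflect b j) → InBox a b i j
  reflect-box⁻ (box 1≤ρi ρi≤a 1≤ρj ρj≤b) =
    box (proj₁ (reflect-∈⁻ 1≤ρi ρi≤a)) (proj₂ (reflect-∈⁻ 1≤ρi ρi≤a))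
        (proj₁ (reflect-∈⁻ 1≤ρj ρj≤b)) (proj₂ (reflect-∈⁻ 1≤ρj ρj≤b))

  Within-rotate : ∀ {X} → Within a b X → Within a b (rotateRegion X)
  Within-rotate within x = reflect-box⁻ (within x)

  Tiles-rotate : ∀ {X G} → Within a b X → Tiles a b X G → Tiles a b (rotateRegion X) (rotatePairing G)
  Tiles-rotate {X} {G} within tX {i} {j} c@(box 1≤i i≤a 1≤j j≤b) = rotateFits (tX (reflect-box c))
    where
    ρi ρj : ℕ
    ρi = reflect a i
    ρj = reflect b j
    rotateFits : ∀ {d} → Fits X G ρi ρj d → Fits (rotateRegion X) (rotatePairing G) i j (opp d)
    rotateFits (vacant ∉X) = vacant ∉X
    rotateFits {right} (domino _ x x' g) = domino 1<i x
        (subst (λ k → T (X k ρj)) (sym ρ[i-1]) x') (cong opp (trans (cong (λ k → G k ρj) ρ[i-1]) g))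
      where
      1<i : 1 < i
      1<i = reflect-edge 1≤i (InBox.i≤a (within x'))
      ρ[i-1] : reflect a (i ∸ 1) ≡ suc ρi
      ρ[i-1] = reflect-pred 1<i (m≤n⇒m≤1+n i≤a)
    rotateFits {left} (domino _ x x' g) = domino tt x
        (subst (λ k → T (X k ρj)) (sym (reflect-suc i)) x')
        (cong opp (trans (cong (λ k → G k ρj) (reflect-suc i)) g))
    rotateFits {up} (domino _ x x' g) = domino 1<j x
        (subst (λ k → T (X ρi k)) (sym ρ[j-1]) x') (cong opp (trans (cong (G ρi) ρ[j-1]) g))
      where
      1<j : 1 < j
      1<j = reflect-edge 1≤j (InBox.j≤b (within x'))
      ρ[j-1] : reflect b (j ∸ 1) ≡ suc ρj
      ρ[j-1] = reflect-pred 1<j (m≤n⇒m≤1+n j≤b)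
    rotateFits {down} (domino _ x x' g) = domino tt x
        (subst (λ k → T (X ρi k)) (sym (reflect-suc j)) x')
        (cong opp (trans (cong (G ρi) (reflect-suc j)) g))

-- Grids

okAt⇒Fits : ∀ X g i j → T (okAt X g i j) → Fits X (get g) i j (get g i j)
okAt⇒Fits X g i j ok with get g i j
... | none  = vacant (T-not⁻ ok)
... | right = let (x , x' , e) = ∧-split′ ok in domino tt x x' (==ᴰ⇒≡ _ left e)
... | up    = let (x , x' , e) = ∧-split′ ok in domino tt x x' (==ᴰ⇒≡ _ down e)
... | left  = let (x , 1<i , x' , e) = ∧-split″ ok in domino (<ᵇ⇒< 1 i 1<i) x x' (==ᴰ⇒≡ _ right e)
... | down  = let (x , 1<j , x' , e) = ∧-split″ ok in domino (<ᵇ⇒< 1 j 1<j) x x' (==ᴰ⇒≡ _ up e)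

Fits⇒okAt : ∀ X g i j → Fits X (get g) i j (get g i j) → T (okAt X g i j)
Fits⇒okAt X g i j fits with get g i j | fits
... | none  | vacant ∉X         = T-not⁺ ∉X
... | right | domino _ x x' e   = ∧-join x (∧-join x' (≡⇒==ᴰ e))
... | up    | domino _ x x' e   = ∧-join x (∧-join x' (≡⇒==ᴰ e))
... | left  | domino 1<i x x' e = ∧-join x (∧-join (<⇒<ᵇ 1<i) (∧-join x' (≡⇒==ᴰ e)))
... | down  | domino 1<j x x' e = ∧-join x (∧-join (<⇒<ᵇ 1<j) (∧-join x' (≡⇒==ᴰ e)))

T-allB⁺ : {A : Set} (p : A → Bool) {xs : List A} → All (T ∘ p) xs → T (allB p xs)
T-allB⁺ p []       = tt
T-allB⁺ p (t ∷ ts) = ∧-join t (T-allB⁺ p ts)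

T-allB⁻ : {A : Set} (p : A → Bool) (xs : List A) → T (allB p xs) → All (T ∘ p) xs
T-allB⁻ p []       _ = []
T-allB⁻ p (x ∷ xs) t = let (px , rest) = ∧-split t in px ∷ T-allB⁻ p xs rest

All-range⁺ : {P : ℕ → Set} {k : ℕ} → (∀ {i} → 1 ≤ i → i ≤ k → P i) → All P (range k)
All-range⁺ {k = k} h = All.map⁺ (All.applyUpTo⁺₁ id k (h (s≤s z≤n)))

All-range⁻ : {P : ℕ → Set} {k : ℕ} → All P (range k) → ∀ {i} → 1 ≤ i → i ≤ k → P i
All-range⁻ {k = k} ps {suc i} _ i<k = All.applyUpTo⁻ id k (All.map⁻ ps) i<k

module _ {a b : ℕ} {X : Region} {g : Grid} where

  isTiling⇒Tiles : T (isTiling a b X g) → Tiles a b X (get g)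
  isTiling⇒Tiles t {i} {j} (box 1≤i i≤a 1≤j j≤b) =
    okAt⇒Fits X g i j (All-range⁻ (T-allB⁻ _ (range b) (All-range⁻ (T-allB⁻ _ (range a) t) 1≤i i≤a)) 1≤j j≤b)

  Tiles⇒isTiling : Tiles a b X (get g) → T (isTiling a b X g)
  Tiles⇒isTiling tiles = T-allB⁺ _ (All-range⁺ λ 1≤i i≤a → T-allB⁺ _ (All-range⁺ λ 1≤j j≤b →
    Fits⇒okAt X g _ _ (tiles (box 1≤i i≤a 1≤j j≤b))))

tabulate₁ : {A : Set} → ℕ → (ℕ → A) → List A
tabulate₁ k f = applyUpTo (f ∘ suc) k

nth-tabulate₁ : {A : Set} (d : A) (f : ℕ → A) {k i : ℕ} → i < k → nth d (tabulate₁ k f) i ≡ f (suc i)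
nth-tabulate₁ d f {suc k} {zero}  _         = refl
nth-tabulate₁ d f {suc k} {suc i} (s≤s i<k) = nth-tabulate₁ d (f ∘ suc) i<k

tabulate₁-cong : {A : Set} {f g : ℕ → A} (k : ℕ) → (∀ {i} → 1 ≤ i → i ≤ k → f i ≡ g i) →
                 tabulate₁ k f ≡ tabulate₁ k g
tabulate₁-cong zero    f≗g = refl
tabulate₁-cong (suc k) f≗g =
  cong₂ _∷_ (f≗g (s≤s z≤n) (s≤s z≤n)) (tabulate₁-cong k (λ _ i≤k → f≗g (s≤s z≤n) (s≤s i≤k)))

applyUpTo-nth : {A : Set} (d : A) (xs : List A) → applyUpTo (nth d xs) (length xs) ≡ xs
applyUpTo-nth d []       = refl
applyUpTo-nth d (x ∷ xs) = cong (x ∷_) (applyUpTo-nth d xs)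

IsSubset : ℕ → List Bool → Set
IsSubset b = ListOf b U

IsGrid : ℕ → ℕ → Grid → Set
IsGrid a b = ListOf a (ListOf b U)

subsets-enumeration : ∀ b → Enumeration (IsSubset b) (subsets b)
subsets-enumeration = enumeration-allLists bools-enumeration

grids-enumeration : ∀ a b → Enumeration (IsGrid a b) (allGrids a b)
grids-enumeration a b = enumeration-allLists (enumeration-allLists dirs-enumeration b) a

ListOf-tabulate₁ : {A : Set} (k : ℕ) (f : ℕ → A) → ListOf k U (tabulate₁ k f)
ListOf-tabulate₁ k f = length-applyUpTo (f ∘ suc) k , All.applyUpTo⁺₂ (f ∘ suc) k (λ _ → tt)

memb-tabulate₁ : ∀ {b} (B : ℕ → Bool) {j} → 1 ≤ j → j ≤ b → memb (tabulate₁ b B) j ≡ B j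
memb-tabulate₁ B {suc j} _ j<b = nth-tabulate₁ false B j<b

tabulate₁-memb : ∀ {b} {A : List Bool} → IsSubset b A → tabulate₁ b (memb A) ≡ A
tabulate₁-memb {A = A} (refl , _) = applyUpTo-nth false A

tabulateGrid : ℕ → ℕ → Pairing → Grid
tabulateGrid a b G = tabulate₁ a (λ i → tabulate₁ b (G i))

module _ (a b : ℕ) where

  IsGrid-tabulateGrid : (G : Pairing) → IsGrid a b (tabulateGrid a b G)
  IsGrid-tabulateGrid G =
    length-applyUpTo _ a , All.applyUpTo⁺₂ _ a (λ i → ListOf-tabulate₁ b (G (suc i)))

  get-tabulateGrid : (G : Pairing) → ∀ {i j} → InBox a b i j → get (tabulateGrid a b G) i j ≡ G i j
  get-tabulateGrid G {suc i} {suc j} (box _ i<a _ j<b) =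
    trans (cong (λ col → nth none col j) (nth-tabulate₁ [] (λ i → tabulate₁ b (G i)) i<a))
          (nth-tabulate₁ none (G (suc i)) j<b)

  tabulateGrid-cong : {G H : Pairing} → (∀ {i j} → InBox a b i j → G i j ≡ H i j) →
                      tabulateGrid a b G ≡ tabulateGrid a b H
  tabulateGrid-cong G≗H =
    tabulate₁-cong a (λ 1≤i i≤a → tabulate₁-cong b (λ 1≤j j≤b → G≗H (box 1≤i i≤a 1≤j j≤b)))

tabulateGrid-get : ∀ {a b} {g : Grid} → IsGrid a b g → tabulateGrid a b (get g) ≡ g
tabulateGrid-get {b = b} {g} (refl , columns) = columnwise g columns
  where
  columnwise : ∀ g → All (ListOf b U) g → applyUpTo (λ i → applyUpTo (nth none (nth [] g i)) b) (length g) ≡ g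
  columnwise []      []                   = refl
  columnwise (c ∷ g) ((refl , _) ∷ cols) = cong₂ _∷_ (applyUpTo-nth none c) (columnwise g cols)

-- Horizontal dominoes

indicator : Dir → Dir → ℕ
indicator d e = if e ==ᴰ d then 1 else 0

boxSum : ℕ → ℕ → (ℕ → ℕ → ℕ) → ℕ
boxSum a b f = sum (map (λ i → sum (map (f i) (range b))) (range a))

count≡sum : {A : Set} (p : A → Bool) (xs : List A) → count p xs ≡ sum (map (λ x → if p x then 1 else 0) xs)
count≡sum p []       = refl
count≡sum p (x ∷ xs) with p x
... | true  = cong suc (count≡sum p xs)
... | false = count≡sum p xs

hor≡boxSum : ∀ a b g → hor a b g ≡ boxSum a b (λ i j → indicator right (get g i j))
hor≡boxSum a b g = cong sum (map-cong (λ i → count≡sum _ (range b)) (range a))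

sum-range-cong : ∀ k {f g : ℕ → ℕ} → (∀ {i} → 1 ≤ i → i ≤ k → f i ≡ g i) →
                 sum (map f (range k)) ≡ sum (map g (range k))
sum-range-cong k f≗g = cong sum (map-cong-local (All-range⁺ f≗g))

sum-map-+ : {A : Set} (f g : A → ℕ) (xs : List A) → sum (map (λ x → f x + g x) xs) ≡ sum (map f xs) + sum (map g xs)
sum-map-+ f g []       = refl
sum-map-+ f g (x ∷ xs) = trans (cong (f x + g x +_) (sum-map-+ f g xs)) (+-interchange (f x) (g x) _ _)

applyUpTo-∸ : ∀ a → applyUpTo (a ∸_) a ≡ applyDownFrom suc a
applyUpTo-∸ zero    = refl
applyUpTo-∸ (suc a) = cong (suc a ∷_) (applyUpTo-∸ a)

map-reflect-range : ∀ a → map (reflect a) (range a) ≡ reverse (range a)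
map-reflect-range a = begin
  map (reflect a) (map suc (upTo a))  ≡⟨ sym (map-∘ (upTo a)) ⟩
  map (a ∸_) (upTo a)                 ≡⟨ map-upTo (a ∸_) a ⟩
  applyUpTo (a ∸_) a                  ≡⟨ applyUpTo-∸ a ⟩
  applyDownFrom suc a                 ≡⟨ sym (reverse-applyUpTo suc a) ⟩
  reverse (applyUpTo suc a)           ≡⟨ cong reverse (sym (map-upTo suc a)) ⟩
  reverse (map suc (upTo a))          ∎

sum-range-reflect : ∀ a (f : ℕ → ℕ) → sum (map (f ∘ reflect a) (range a)) ≡ sum (map f (range a))
sum-range-reflect a f = begin
  sum (map (f ∘ reflect a) (range a))  ≡⟨ cong sum (map-∘ (range a)) ⟩
  sum (map f (map (reflect a) (range a)))  ≡⟨ cong (sum ∘ map f) (map-reflect-range a) ⟩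
  sum (map f (reverse (range a)))  ≡⟨ cong sum (reverse-map f (range a)) ⟩
  sum (reverse (map f (range a)))  ≡⟨ sum-↭ (↭-reverse (map f (range a))) ⟩
  sum (map f (range a))  ∎

sum-range-pred : ∀ a (R : ℕ → ℕ) → R 0 + sum (map R (range a)) ≡ sum (map (R ∘ (_∸ 1)) (range a)) + R a
sum-range-pred a R = begin
  R 0 + sum (map R (map suc (upTo a)))  ≡⟨ cong (λ xs → R 0 + sum (map R xs)) (map-upTo suc a) ⟩
  sum (map R (upTo (suc a)))             ≡⟨ cong (sum ∘ map R) (sym (upTo-∷ʳ a)) ⟩
  sum (map R (upTo a ++ a ∷ []))         ≡⟨ cong sum (map-++ R (upTo a) (a ∷ [])) ⟩
  sum (map R (upTo a) ++ R a ∷ [])       ≡⟨ sum-++ (map R (upTo a)) (R a ∷ []) ⟩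
  sum (map R (upTo a)) + (R a + 0)       ≡⟨ cong₂ _+_ (cong sum (map-∘ (upTo a))) (+-identityʳ (R a)) ⟩
  sum (map (R ∘ (_∸ 1)) (range a)) + R a ∎

module _ (a b : ℕ) where

  boxSum-cong : {f g : ℕ → ℕ → ℕ} → (∀ {i j} → InBox a b i j → f i j ≡ g i j) → boxSum a b f ≡ boxSum a b g
  boxSum-cong f≗g = sum-range-cong a (λ 1≤i i≤a → sum-range-cong b (λ 1≤j j≤b → f≗g (box 1≤i i≤a 1≤j j≤b)))

  boxSum-+ : (f g : ℕ → ℕ → ℕ) → boxSum a b (λ i j → f i j + g i j) ≡ boxSum a b f + boxSum a b g
  boxSum-+ f g = trans (cong sum (map-cong (λ i → sum-map-+ (f i) (g i) (range b)) (range a)))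
                       (sum-map-+ _ _ (range a))

  boxSum-rotate : (f : ℕ → ℕ → ℕ) → boxSum a b (λ i j → f (reflect a i) (reflect b j)) ≡ boxSum a b f
  boxSum-rotate f = trans (cong sum (map-cong (λ i → sum-range-reflect b (f (reflect a i))) (range a)))
                          (sum-range-reflect a (λ i → sum (map (f i) (range b))))

indicator-⇔ : ∀ {d e x y} → (x ≡ d → y ≡ e) → (y ≡ e → x ≡ d) → indicator d x ≡ indicator e y
indicator-⇔ {d} {e} {x} {y} to from with x ==ᴰ d in p | y ==ᴰ e in q
... | true  | true  = refl
... | false | false = refl
... | true  | false = ⊥-elim (subst T q (≡⇒==ᴰ (to (==ᴰ⇒≡ x d (subst T (sym p) tt)))))
... | false | true  = ⊥-elim (subst T p (≡⇒==ᴰ (from (==ᴰ⇒≡ y e (subst T (sym q) tt)))))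

sum-map-0 : {A : Set} (xs : List A) → sum (map (λ _ → 0) xs) ≡ 0
sum-map-0 []       = refl
sum-map-0 (x ∷ xs) = sum-map-0 xs

module HorizontalDominoes {a b : ℕ} {X : Region} {g : Grid} (within : Within a b X) (tiles : Tiles a b X (get g)) where

  left⇒right : ∀ {i j} → InBox a b i j → get g i j ≡ left → get g (i ∸ 1) j ≡ right
  left⇒right {i} {j} c = leftPartner (tiles c)
    where
    leftPartner : ∀ {d} → Fits X (get g) i j d → d ≡ left → get g (i ∸ 1) j ≡ right
    leftPartner (domino _ _ _ e) refl = e

  right⇒left : ∀ {i j} → InBox a b i j → get g (i ∸ 1) j ≡ right → get g i j ≡ left
  right⇒left {suc zero}    _ ()
  right⇒left {suc (suc i)} {j} (box _ i≤a 1≤j j≤b) = rightPartner (tiles (box (s≤s z≤n) (<⇒≤ i≤a) 1≤j j≤b))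
    where
    rightPartner : ∀ {d} → Fits X (get g) (suc i) j d → d ≡ right → get g (suc (suc i)) j ≡ left
    rightPartner (domino _ _ _ e) refl = e

  right-edge : ∀ {j} → 1 ≤ a → 1 ≤ j → j ≤ b → indicator right (get g a j) ≡ 0
  right-edge {j} 1≤a 1≤j j≤b = noRight (tiles (box 1≤a ≤-refl 1≤j j≤b))
    where
    noRight : ∀ {d} → Fits X (get g) a j d → indicator right d ≡ 0
    noRight (vacant _)                 = refl
    noRight {right} (domino _ _ x' _) = ⊥-elim (1+n≰n (InBox.i≤a (within x')))
    noRight {left}  (domino _ _ _ _)  = refl
    noRight {up}    (domino _ _ _ _)  = refl
    noRight {down}  (domino _ _ _ _)  = refl

-- Left cells in column i are the right cells of column i ∸ 1, and columns 0 and a contain no right cell.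
lefts≡rights : ∀ {a b X g} → Within a b X → Tiles a b X (get g) →
               boxSum a b (λ i j → indicator left (get g i j)) ≡ boxSum a b (λ i j → indicator right (get g i j))
lefts≡rights {zero}  _      _     = refl
lefts≡rights {suc a} {b} {X} {g} within tiles = begin
  sum (map (column left) (range (suc a)))
    ≡⟨ sum-range-cong (suc a) (λ 1≤i i≤a → sum-range-cong b (λ 1≤j j≤b → let c = box 1≤i i≤a 1≤j j≤b in
         indicator-⇔ (left⇒right c) (right⇒left c))) ⟩
  sum (map (R ∘ (_∸ 1)) (range (suc a)))
    ≡⟨ sym (trans (cong (sum (map (R ∘ (_∸ 1)) (range (suc a))) +_) R-edge) (+-identityʳ _)) ⟩
  sum (map (R ∘ (_∸ 1)) (range (suc a))) + R (suc a)
    ≡⟨ sym (sum-range-pred (suc a) R) ⟩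
  R 0 + sum (map R (range (suc a)))
    ≡⟨ cong (_+ sum (map R (range (suc a)))) (sum-map-0 (range b)) ⟩
  sum (map R (range (suc a))) ∎
  where
  open HorizontalDominoes within tiles
  column : Dir → ℕ → ℕ
  column d i = sum (map (λ j → indicator d (get g i j)) (range b))
  R : ℕ → ℕ
  R = column right
  R-edge : R (suc a) ≡ 0
  R-edge = trans (sum-range-cong b (right-edge (s≤s z≤n))) (sum-map-0 (range b))

indicator-opp : ∀ d → indicator right (opp d) ≡ indicator left d
indicator-opp none  = refl
indicator-opp right = refl
indicator-opp left  = refl
indicator-opp up    = refl
indicator-opp down  = refl

-- S a b X is ∑ (allGrids a b) (weight a b X) by definition.
weight : ℕ → ℕ → Region → Grid → 𝔾
weight a b X g = if isTiling a b X g then ι^ (hor a b g) else 0𝔾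

weight-inside : ∀ a b X g → T (isTiling a b X g) → weight a b X g ≡ ι^ (hor a b g)
weight-inside a b X g t rewrite T⇒≡true t = refl

weight-outside : ∀ a b X g → ¬ T (isTiling a b X g) → weight a b X g ≡ 0𝔾
weight-outside a b X g ¬t rewrite ¬T⇒≡false ¬t = refl

-- The staircase regions

backward : Dir → Bool
backward left = true
backward down = true
backward _    = false

backward-opp : ∀ d → T (backward d) → backward (opp d) ≡ false
backward-opp left _ = refl
backward-opp down _ = refl

pred-sumˣ : ∀ {i} j → 1 < i → (i ∸ 1) + j < i + j
pred-sumˣ {suc zero}    j (s≤s ())
pred-sumˣ {suc (suc i)} j _ = n<1+n _

pred-sumʸ : ∀ i {j} → 1 < j → i + (j ∸ 1) < i + j
pred-sumʸ i {suc zero}    (s≤s ())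
pred-sumʸ i {suc (suc j)} _ = +-monoʳ-< i (n<1+n (suc j))

-- Y B is YB (suc a) (suc b) B with ⌊ suc a + suc b /2⌋ abstracted to h.
module Staircase (a b h : ℕ) (a+b+2≡h+h : suc a + suc b ≡ h + h) (b<a : b < a) where

  R : Region
  R = Rect a b

  Y : (ℕ → Bool) → Region
  Y B i j = (inBox a b i j ∧ (i + j <ᵇ h)) ∨ ((1 ≤ᵇ j) ∧ (j ≤ᵇ b) ∧ B j ∧ (1 ≤ᵇ i) ∧ (i + j ≡ᵇ h))

  belowOrOn : ℕ → Bool → Bool
  belowOrOn s m = (s <ᵇ h) ∨ (m ∧ (s ≡ᵇ h))

  h≤a : h ≤ a
  h≤a = ≮⇒≥ λ a<h → <⇒≱ b<a (≤-pred (+-cancelˡ-≤ (suc a) _ _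
    (subst (suc a + suc a ≤_) (sym a+b+2≡h+h) (+-mono-≤ a<h a<h))))

  b<h : b < h
  b<h = ≰⇒> λ h≤b → <-irrefl (sym a+b+2≡h+h)
    (≤-<-trans (+-mono-≤ h≤b h≤b) (+-mono-< (m<n⇒m<1+n b<a) (n<1+n b)))

  inBox⇒InBox : ∀ {i j} → T (inBox a b i j) → InBox a b i j
  inBox⇒InBox {i} {j} t = let (1≤i , i≤a , 1≤j , j≤b) = ∧-split″ t in
    box (≤ᵇ⇒≤ 1 i 1≤i) (≤ᵇ⇒≤ i a i≤a) (≤ᵇ⇒≤ 1 j 1≤j) (≤ᵇ⇒≤ j b j≤b)

  R-box : ∀ {i j} → InBox a b i j → R i j ≡ true
  R-box (box 1≤i i≤a 1≤j j≤b) rewrite ≤ᵇ-true 1≤i | ≤ᵇ-true i≤a | ≤ᵇ-true 1≤j | ≤ᵇ-true j≤b = refl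

  Within-R : Within a b R
  Within-R = inBox⇒InBox

  Y-box : ∀ B {i j} → InBox a b i j → Y B i j ≡ belowOrOn (i + j) (B j)
  Y-box B (box 1≤i i≤a 1≤j j≤b) rewrite ≤ᵇ-true 1≤i | ≤ᵇ-true i≤a | ≤ᵇ-true 1≤j | ≤ᵇ-true j≤b = refl

  belowOrOn-< : ∀ {s} m → s < h → belowOrOn s m ≡ true
  belowOrOn-< m s<h rewrite T⇒≡true (<⇒<ᵇ s<h) = refl

  belowOrOn-≡ : ∀ m → belowOrOn h m ≡ m
  belowOrOn-≡ m rewrite ¬T⇒≡false (<-irrefl refl ∘ <ᵇ⇒< h h) | T⇒≡true (≡⇒≡ᵇ h h refl) = ∧-identityʳ m

  belowOrOn-> : ∀ {s} m → h < s → belowOrOn s m ≡ false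
  belowOrOn-> {s} m h<s
    rewrite ¬T⇒≡false (<-asym h<s ∘ <ᵇ⇒< s h) | ¬T⇒≡false ((λ s≡h → <-irrefl (sym s≡h) h<s) ∘ ≡ᵇ⇒≡ s h)
    = ∧-zeroʳ m

  Y-below : ∀ B {i j} → InBox a b i j → i + j < h → T (Y B i j)
  Y-below B c s<h = subst T (sym (trans (Y-box B c) (belowOrOn-< _ s<h))) tt

  Y-diagonal : ∀ B {i j} → InBox a b i j → i + j ≡ h → Y B i j ≡ B j
  Y-diagonal B {j = j} c s≡h = trans (Y-box B c) (trans (cong (λ s → belowOrOn s (B j)) s≡h) (belowOrOn-≡ (B j)))

  Y-above : ∀ B {i j} → InBox a b i j → h < i + j → ¬ T (Y B i j)
  Y-above B c h<s y = subst T (trans (Y-box B c) (belowOrOn-> _ h<s)) y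

  Y⇒≤ : ∀ B {i j} → InBox a b i j → T (Y B i j) → i + j ≤ h
  Y⇒≤ B c y = ≮⇒≥ (λ h<s → Y-above B c h<s y)

  Within-Y : ∀ B → Within a b (Y B)
  Within-Y B {i} {j} y with Equivalence.to T-∨ y
  ... | inj₁ lower = inBox⇒InBox (proj₁ (∧-split lower))
  ... | inj₂ diagonal = let (1≤j , j≤b , rest) = ∧-split′ diagonal
                            (_ , 1≤i , s≡h) = ∧-split′ {B j} rest in
    box (≤ᵇ⇒≤ 1 i 1≤i) (≤-trans (m≤m+n i j) (≤-trans (≤-reflexive (≡ᵇ⇒≡ _ h s≡h)) h≤a))
        (≤ᵇ⇒≤ 1 j 1≤j) (≤ᵇ⇒≤ j b j≤b)

  reflCompl-reflect : ∀ A {j} → 1 ≤ j → j ≤ b → reflCompl (suc b) A (reflect b j) ≡ not (memb A j)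
  reflCompl-reflect A 1≤j j≤b
    rewrite ≤ᵇ-true (proj₁ (reflect-∈ 1≤j j≤b)) | ≤ᵇ-true (proj₂ (reflect-∈ 1≤j j≤b))
          | reflect-involutive (m≤n⇒m≤1+n j≤b) = refl

  reflect-sum : ∀ {i j} → InBox a b i j → (reflect a i + reflect b j) + (i + j) ≡ h + h
  reflect-sum {i} {j} (box _ i≤a _ j≤b) = begin
    (reflect a i + reflect b j) + (i + j)  ≡⟨ +-interchange (reflect a i) (reflect b j) i j ⟩
    (reflect a i + i) + (reflect b j + j)  ≡⟨ cong₂ _+_ (m∸n+n≡m (m≤n⇒m≤1+n i≤a)) (m∸n+n≡m (m≤n⇒m≤1+n j≤b)) ⟩
    suc a + suc b                          ≡⟨ a+b+2≡h+h ⟩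
    h + h                                  ∎

  mirror-above : ∀ {s s'} → s' + s ≡ h + h → s < h → h < s'
  mirror-above sum s<h = ≰⇒> (λ s'≤h → <-irrefl sum (+-mono-≤-< s'≤h s<h))

  mirror-below : ∀ {s s'} → s' + s ≡ h + h → h < s → s' < h
  mirror-below sum h<s = ≰⇒> (λ h≤s' → <-irrefl (sym sum) (+-mono-≤-< h≤s' h<s))

  belowOrOn-mirror : ∀ {s s'} m → s' + s ≡ h + h → belowOrOn s' (not m) ≡ not (belowOrOn s m)
  belowOrOn-mirror {s} {s'} m sum with <-cmp s h
  ... | tri< s<h _ _ rewrite belowOrOn-< m s<h | belowOrOn-> (not m) (mirror-above sum s<h) = refl
  ... | tri> _ _ h<s rewrite belowOrOn-< (not m) (mirror-below sum h<s) | belowOrOn-> m h<s = refl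
  ... | tri≈ _ refl _ rewrite +-cancelʳ-≡ h s' h sum | belowOrOn-≡ m = belowOrOn-≡ (not m)

  complement : ∀ A {i j} → InBox a b i j →
               Y (reflCompl (suc b) A) (reflect a i) (reflect b j) ≡ not (Y (memb A) i j)
  complement A {i} {j} c@(box _ _ 1≤j j≤b) = begin
    Y (reflCompl (suc b) A) (reflect a i) (reflect b j)
      ≡⟨ Y-box (reflCompl (suc b) A) (reflect-box a b c) ⟩
    belowOrOn (reflect a i + reflect b j) (reflCompl (suc b) A (reflect b j))
      ≡⟨ cong (belowOrOn _) (reflCompl-reflect A 1≤j j≤b) ⟩
    belowOrOn (reflect a i + reflect b j) (not (memb A j))
      ≡⟨ belowOrOn-mirror (memb A j) (reflect-sum c) ⟩
    not (belowOrOn (i + j) (memb A j))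
      ≡⟨ cong not (sym (Y-box (memb A) c)) ⟩
    not (Y (memb A) i j) ∎

  diagonal-backward : ∀ B {G i j} → Tiles a b (Y B) G → InBox a b i j → i + j ≡ h → T (Y B i j) →
                      T (backward (G i j))
  diagonal-backward B {G} {i} {j} tY c s≡h y = backwardAt (tY c)
    where
    beyond : ∀ {i' j'} → T (Y B i' j') → i' + j' ≡ suc (i + j) → ⊥
    beyond {i'} {j'} y' s'≡ =
      1+n≰n (subst (_≤ h) (trans s'≡ (cong suc s≡h)) (Y⇒≤ B (Within-Y B {i'} {j'} y') y'))
    backwardAt : ∀ {d} → Fits (Y B) G i j d → T (backward d)
    backwardAt (vacant ∉Y)               = ⊥-elim (∉Y y)
    backwardAt {right} (domino _ _ y' _) = ⊥-elim (beyond {suc i} {j} y' refl)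
    backwardAt {up}    (domino _ _ y' _) = ⊥-elim (beyond {i} {suc j} y' (+-suc i j))
    backwardAt {left}  _                 = tt
    backwardAt {down}  _                 = tt

  diagonalSubset : Grid → List Bool
  diagonalSubset g = tabulate₁ b (λ j → backward (get g (h ∸ j) j))

  memb-diagonalSubset : ∀ g {i j} → InBox a b i j → i + j ≡ h → memb (diagonalSubset g) j ≡ backward (get g i j)
  memb-diagonalSubset g {i} {j} (box _ _ 1≤j j≤b) s≡h =
    trans (memb-tabulate₁ (λ j → backward (get g (h ∸ j) j)) 1≤j j≤b)
          (cong (λ k → backward (get g k j)) (trans (cong (_∸ j) (sym s≡h)) (m+n∸n≡m i j)))

  -- A forward domino from the lower region cannot start on the diagonal (its diagonal cells point
  -- backward); if it ends on the diagonal, its end points backward and so lies in the region again.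
  Closed-lower : ∀ g → Tiles a b R (get g) → Closed a b (Y (memb (diagonalSubset g))) (get g)
  Closed-lower g tR {i} {j} c z = partnerIn refl (tR c)
    where
    B : ℕ → Bool
    B = memb (diagonalSubset g)
    Z : Region
    Z = Y B
    s≤h : i + j ≤ h
    s≤h = Y⇒≤ B c z

    s<h : ¬ T (backward (get g i j)) → i + j < h
    s<h ¬bw with m≤n⇒m<n∨m≡n s≤h
    ... | inj₁ s<h' = s<h'
    ... | inj₂ s≡h  = ⊥-elim (¬bw (subst T (trans (Y-diagonal B c s≡h) (memb-diagonalSubset g c s≡h)) z))

    advance : ∀ {i' j'} → InBox a b i' j' → i' + j' ≡ suc (i + j) → T (backward (get g i' j')) →
              ¬ T (backward (get g i j)) → T (Z i' j')
    advance c' s'≡ bw' ¬bw with m≤n⇒m<n∨m≡n (subst (_≤ h) (sym s'≡) (s<h ¬bw))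
    ... | inj₁ s'<h = Y-below B c' s'<h
    ... | inj₂ s'≡h = subst T (sym (trans (Y-diagonal B c' s'≡h) (memb-diagonalSubset g c' s'≡h))) bw'

    partnerIn : ∀ {d} → get g i j ≡ d → Fits R (get g) i j d → T (Z (shiftˣ d i) (shiftʸ d j))
    partnerIn _ (vacant _) = z
    partnerIn {right} e (domino _ _ r' e') =
      advance {suc i} {j} (Within-R r') refl (subst (T ∘ backward) (sym e') tt) (subst (T ∘ backward) e)
    partnerIn {up} e (domino _ _ r' e') =
      advance {i} {suc j} (Within-R r') (+-suc i j) (subst (T ∘ backward) (sym e') tt) (subst (T ∘ backward) e)
    partnerIn {left} _ (domino 1<i _ r' _) = Y-below B (Within-R {i ∸ 1} {j} r') (<-≤-trans (pred-sumˣ j 1<i) s≤h)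
    partnerIn {down} _ (domino 1<j _ r' _) = Y-below B (Within-R {i} {j ∸ 1} r') (<-≤-trans (pred-sumʸ i 1<j) s≤h)

  -- Y₁ A is Y_{n-A^c} and Y₂ A is Y_A; by complement, Y₁ A is the rotated complement of Y₂ A in the box.
  Y₁ Y₂ : List Bool → Region
  Y₁ A = Y (reflCompl (suc b) A)
  Y₂ A = Y (memb A)

  reflect-twice : ∀ {i j} → InBox a b i j → reflect a (reflect a i) ≡ i × reflect b (reflect b j) ≡ j
  reflect-twice (box _ i≤a _ j≤b) = reflect-involutive (m≤n⇒m≤1+n i≤a) , reflect-involutive (m≤n⇒m≤1+n j≤b)

  complement-reflected : ∀ A {i j} → InBox a b i j → Y₁ A i j ≡ not (Y₂ A (reflect a i) (reflect b j))
  complement-reflected A c = trans (sym (cong₂ (Y₁ A) (proj₁ (reflect-twice c)) (proj₂ (reflect-twice c))))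
                          (complement A (reflect-box a b c))

  R-in : ∀ {i j} → InBox a b i j → T (R i j)
  R-in c = subst T (sym (R-box c)) tt

  lowerRegion : Grid → Region
  lowerRegion g = Y₂ (diagonalSubset g)

  lowerGrid upperGrid : Grid → Grid
  lowerGrid g = tabulateGrid a b (restrict (lowerRegion g) (get g))
  upperGrid g = tabulateGrid a b (rotatePairing a b (restrict (R ∖ lowerRegion g) (get g)))

  split : Grid → List Bool × Grid × Grid
  split g = diagonalSubset g , upperGrid g , lowerGrid g

  glue : List Bool × Grid × Grid → Grid
  glue (A , g₁ , g₂) = tabulateGrid a b (merge (Y₂ A) (get g₂) (rotatePairing a b (get g₁)))

  module Split (g : Grid) (tR : Tiles a b R (get g)) where

    Z : Region

    Z = lowerRegion g

    Within-Z : Within a b Z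
    Within-Z = Within-Y (memb (diagonalSubset g))

    Within-R∖Z : Within a b (R ∖ Z)
    Within-R∖Z {i} {j} r = Within-R {i} {j} (∖-⊆ R Z {i} {j} r)

    Tiles-lowerGrid : Tiles a b Z (get (lowerGrid g))
    Tiles-lowerGrid = Tiles-cong a b Within-Z (λ _ → refl) (get-tabulateGrid a b (restrict Z (get g)))
      (Tiles-restrict a b tR (λ {i} {j} z → R-in (Within-Z {i} {j} z)) (Closed-lower g tR))

    Tiles-upperGrid : Tiles a b (Y₁ (diagonalSubset g)) (get (upperGrid g))
    Tiles-upperGrid =
      Tiles-cong a b (Within-rotate a b Within-R∖Z) upper≡ (get-tabulateGrid a b (rotatePairing a b G∖Z))
        (Tiles-rotate a b Within-R∖Z (Tiles-restrict a b tR (λ {i} {j} → ∖-⊆ R Z {i} {j})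
          (Closed-∖ a b Within-R tR (Closed-lower g tR))))
      where
      G∖Z : Pairing
      G∖Z = restrict (R ∖ Z) (get g)
      upper≡ : ∀ {i j} → InBox a b i j → Y₁ (diagonalSubset g) i j ≡ rotateRegion a b (R ∖ Z) i j
      upper≡ {i} {j} c = trans (complement-reflected _ c)
        (sym (cong (_∧ not (Z (reflect a i) (reflect b j))) (R-box (reflect-box a b c))))

    glue-split : IsGrid a b g → glue (split g) ≡ g
    glue-split isGrid = trans (tabulateGrid-cong a b pointwise) (tabulateGrid-get isGrid)
      where
      lower upper : Pairing
      lower = get (lowerGrid g)
      upper = rotatePairing a b (get (upperGrid g))
      pointwise : ∀ {i j} → InBox a b i j → merge Z lower upper i j ≡ get g i j
      pointwise {i} {j} c with T? (Z i j)
      ... | yes z = begin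
        merge Z lower upper i j  ≡⟨ merge-in Z lower upper {i} {j} z ⟩
        lower i j                ≡⟨ get-tabulateGrid a b (restrict Z (get g)) c ⟩
        restrict Z (get g) i j   ≡⟨ merge-in Z (get g) (λ _ _ → none) {i} {j} z ⟩
        get g i j                ∎
      ... | no ∉Z = begin
        merge Z lower upper i j  ≡⟨ merge-out Z lower upper {i} {j} ∉Z ⟩
        opp (get (upperGrid g) ρi ρj)
          ≡⟨ cong opp (get-tabulateGrid a b (rotatePairing a b (restrict (R ∖ Z) (get g))) (reflect-box a b c)) ⟩
        opp (opp (restrict (R ∖ Z) (get g) (reflect a ρi) (reflect b ρj)))
          ≡⟨ opp-involutive _ ⟩
        restrict (R ∖ Z) (get g) (reflect a ρi) (reflect b ρj)
          ≡⟨ cong₂ (restrict (R ∖ Z) (get g)) (proj₁ (reflect-twice c)) (proj₂ (reflect-twice c)) ⟩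
        restrict (R ∖ Z) (get g) i j
          ≡⟨ merge-in (R ∖ Z) (get g) (λ _ _ → none) {i} {j} (∖-in R Z {i} {j} (R-in c) ∉Z) ⟩
        get g i j                     ∎
        where
        ρi ρj : ℕ
        ρi = reflect a i
        ρj = reflect b j

  diagonal-point : ∀ {j} → 1 ≤ j → j ≤ b → InBox a b (h ∸ j) j × (h ∸ j) + j ≡ h
  diagonal-point {j} 1≤j j≤b =
    box (m<n⇒0<n∸m j<h) (≤-trans (m∸n≤m h j) h≤a) 1≤j j≤b , m∸n+n≡m (<⇒≤ j<h)
    where j<h = ≤-<-trans j≤b b<h

  module Glue (A : List Bool) (g₁ g₂ : Grid) (t₁ : Tiles a b (Y₁ A) (get g₁)) (t₂ : Tiles a b (Y₂ A) (get g₂)) where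

    M : Pairing
    M = merge (Y₂ A) (get g₂) (rotatePairing a b (get g₁))

    private
      g : Grid
      g = glue (A , g₁ , g₂)

    get-glue : ∀ {i j} → InBox a b i j → get g i j ≡ M i j
    get-glue = get-tabulateGrid a b M

    glue-in : ∀ {i j} → InBox a b i j → T (Y₂ A i j) → get g i j ≡ get g₂ i j
    glue-in {i} {j} c y₂ = trans (get-glue c) (merge-in (Y₂ A) (get g₂) (rotatePairing a b (get g₁)) {i} {j} y₂)

    glue-out : ∀ {i j} → InBox a b i j → ¬ T (Y₂ A i j) → get g i j ≡ opp (get g₁ (reflect a i) (reflect b j))
    glue-out {i} {j} c ∉Y₂ = trans (get-glue c) (merge-out (Y₂ A) (get g₂) (rotatePairing a b (get g₁)) {i} {j} ∉Y₂)

    rotated-vacant : ∀ {i j} → InBox a b i j → T (Y₂ A i j) → get g₁ (reflect a i) (reflect b j) ≡ none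
    rotated-vacant c y₂ = vacant⇒none a b t₁ (reflect-box a b c) (λ y₁ → T-not⁻ (subst T (complement A c) y₁) y₂)

    Tiles-glue : Tiles a b R (get g)
    Tiles-glue = Tiles-cong a b Within-∪ R≡∪ get-glue
      (Tiles-∪ a b {X = Y₂ A} {Y = rotateRegion a b (Y₁ A)} t₂ (Tiles-rotate a b (Within-Y (reflCompl (suc b) A)) t₁)
        (λ {i} {j} → disjoint {i} {j}))
      where
      disjoint : ∀ {i j} → T (Y₂ A i j) → ¬ T (rotateRegion a b (Y₁ A) i j)
      disjoint {i} {j} y₂ y₁ = T-not⁻ (subst T (complement A (Within-Y (memb A) {i} {j} y₂)) y₁) y₂
      Within-∪ : Within a b (Y₂ A ∪ rotateRegion a b (Y₁ A))
      Within-∪ {i} {j} y with Equivalence.to T-∨ y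
      ... | inj₁ y₂ = Within-Y (memb A) {i} {j} y₂
      ... | inj₂ y₁ = Within-rotate a b (Within-Y (reflCompl (suc b) A)) {i} {j} y₁
      R≡∪ : ∀ {i j} → InBox a b i j → R i j ≡ (Y₂ A ∪ rotateRegion a b (Y₁ A)) i j
      R≡∪ {i} {j} c = begin
        R i j                                        ≡⟨ R-box c ⟩
        true                                         ≡⟨ sym (∨-inverseʳ (Y₂ A i j)) ⟩
        Y₂ A i j ∨ not (Y₂ A i j)                    ≡⟨ cong (Y₂ A i j ∨_) (sym (complement A c)) ⟩
        Y₂ A i j ∨ Y₁ A (reflect a i) (reflect b j)  ∎

    diagonalSubset-glue : IsSubset b A → diagonalSubset g ≡ A
    diagonalSubset-glue isSubset = trans (tabulate₁-cong b pointwise) (tabulate₁-memb isSubset)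
      where
      pointwise : ∀ {j} → 1 ≤ j → j ≤ b → backward (get g (h ∸ j) j) ≡ memb A j
      pointwise {j} 1≤j j≤b with diagonal-point 1≤j j≤b
      ... | c , s≡h with T? (memb A j)
      ...   | yes m = begin
        backward (get g (h ∸ j) j)     ≡⟨ cong backward (glue-in c y₂) ⟩
        backward (get g₂ (h ∸ j) j)    ≡⟨ T⇒≡true (diagonal-backward (memb A) t₂ c s≡h y₂) ⟩
        true                           ≡⟨ sym (T⇒≡true m) ⟩
        memb A j                       ∎
        where
        y₂ : T (Y₂ A (h ∸ j) j)
        y₂ = subst T (sym (Y-diagonal (memb A) c s≡h)) m
      ...   | no ¬m = begin
        backward (get g (h ∸ j) j)     ≡⟨ cong backward (glue-out c ∉Y₂) ⟩
        backward (opp (get g₁ ρi ρj))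
          ≡⟨ backward-opp _ (diagonal-backward (reflCompl (suc b) A) t₁ (reflect-box a b c) ρs≡h y₁) ⟩
        false                          ≡⟨ sym (¬T⇒≡false ¬m) ⟩
        memb A j                       ∎
        where
        ρi ρj : ℕ
        ρi = reflect a (h ∸ j)
        ρj = reflect b j
        ∉Y₂ : ¬ T (Y₂ A (h ∸ j) j)
        ∉Y₂ = ¬m ∘ subst T (Y-diagonal (memb A) c s≡h)
        y₁ : T (Y₁ A ρi ρj)
        y₁ = subst T (sym (complement A c)) (T-not⁺ ∉Y₂)
        ρs≡h : ρi + ρj ≡ h
        ρs≡h = +-cancelʳ-≡ (h ∸ j + j) _ _ (trans (reflect-sum c) (cong (h +_) (sym s≡h)))

    lowerGrid-glue : IsSubset b A → IsGrid a b g₂ → lowerGrid g ≡ g₂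
    lowerGrid-glue isSubset isGrid₂ = begin
      tabulateGrid a b (restrict (Y₂ (diagonalSubset g)) (get g))
        ≡⟨ cong (λ B → tabulateGrid a b (restrict (Y₂ B) (get g))) (diagonalSubset-glue isSubset) ⟩
      tabulateGrid a b (restrict (Y₂ A) (get g))  ≡⟨ tabulateGrid-cong a b pointwise ⟩
      tabulateGrid a b (get g₂)                   ≡⟨ tabulateGrid-get isGrid₂ ⟩
      g₂                                          ∎
      where
      pointwise : ∀ {i j} → InBox a b i j → restrict (Y₂ A) (get g) i j ≡ get g₂ i j
      pointwise {i} {j} c with T? (Y₂ A i j)
      ... | yes y₂ = trans (merge-in (Y₂ A) (get g) (λ _ _ → none) {i} {j} y₂) (glue-in c y₂)
      ... | no ∉Y₂ = trans (merge-out (Y₂ A) (get g) (λ _ _ → none) {i} {j} ∉Y₂) (sym (vacant⇒none a b t₂ c ∉Y₂))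

    upperGrid-glue : IsSubset b A → IsGrid a b g₁ → upperGrid g ≡ g₁
    upperGrid-glue isSubset isGrid₁ = begin
      tabulateGrid a b (rotatePairing a b (restrict (R ∖ Y₂ (diagonalSubset g)) (get g)))
        ≡⟨ cong (λ B → tabulateGrid a b (rotatePairing a b (restrict (R ∖ Y₂ B) (get g))))
                (diagonalSubset-glue isSubset) ⟩
      tabulateGrid a b (rotatePairing a b (restrict (R ∖ Y₂ A) (get g)))  ≡⟨ tabulateGrid-cong a b pointwise ⟩
      tabulateGrid a b (get g₁)                                          ≡⟨ tabulateGrid-get isGrid₁ ⟩
      g₁                                                                 ∎
      where
      pointwise : ∀ {i j} → InBox a b i j → rotatePairing a b (restrict (R ∖ Y₂ A) (get g)) i j ≡ get g₁ i j
      pointwise {i} {j} c with T? (Y₁ A i j)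
      ... | yes y₁ = begin
        opp (restrict (R ∖ Y₂ A) (get g) ρi ρj)
          ≡⟨ cong opp (merge-in (R ∖ Y₂ A) (get g) (λ _ _ → none) {ρi} {ρj}
                                (∖-in R (Y₂ A) {ρi} {ρj} (R-in ρc) ∉Y₂)) ⟩
        opp (get g ρi ρj)                     ≡⟨ cong opp (glue-out ρc ∉Y₂) ⟩
        opp (opp (get g₁ (reflect a ρi) (reflect b ρj)))  ≡⟨ opp-involutive _ ⟩
        get g₁ (reflect a ρi) (reflect b ρj)  ≡⟨ cong₂ (get g₁) (proj₁ (reflect-twice c)) (proj₂ (reflect-twice c)) ⟩
        get g₁ i j                            ∎
        where
        ρi ρj : ℕ
        ρi = reflect a i
        ρj = reflect b j
        ρc : InBox a b ρi ρj
        ρc = reflect-box a b c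
        ∉Y₂ : ¬ T (Y₂ A ρi ρj)
        ∉Y₂ = T-not⁻ (subst T (complement-reflected A c) y₁)
      ... | no ∉Y₁ = trans (cong opp (merge-out (R ∖ Y₂ A) (get g) (λ _ _ → none) {reflect a i} {reflect b j} ∉R∖Y₂))
                           (sym (vacant⇒none a b t₁ c ∉Y₁))
        where
        y₂ : T (Y₂ A (reflect a i) (reflect b j))
        y₂ = ¬T-not⇒T (∉Y₁ ∘ subst T (sym (complement-reflected A c)))
        ∉R∖Y₂ : ¬ T ((R ∖ Y₂ A) (reflect a i) (reflect b j))
        ∉R∖Y₂ r = ∖-out R (Y₂ A) {reflect a i} {reflect b j} r y₂

    hor-glue : hor a b g ≡ hor a b g₁ + hor a b g₂
    hor-glue = begin
      hor a b g
        ≡⟨ hor≡boxSum a b g ⟩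
      boxSum a b (λ i j → indicator right (get g i j))
        ≡⟨ boxSum-cong a b pointwise ⟩
      boxSum a b (λ i j → indicator right (get g₂ i j) + indicator left (get g₁ (reflect a i) (reflect b j)))
        ≡⟨ boxSum-+ a b _ _ ⟩
      boxSum a b (λ i j → indicator right (get g₂ i j))
        + boxSum a b (λ i j → indicator left (get g₁ (reflect a i) (reflect b j)))
        ≡⟨ cong₂ _+_ (sym (hor≡boxSum a b g₂)) (boxSum-rotate a b (λ i j → indicator left (get g₁ i j))) ⟩
      hor a b g₂ + boxSum a b (λ i j → indicator left (get g₁ i j))
        ≡⟨ cong (hor a b g₂ +_) (lefts≡rights (Within-Y (reflCompl (suc b) A)) t₁) ⟩
      hor a b g₂ + boxSum a b (λ i j → indicator right (get g₁ i j))
        ≡⟨ cong (hor a b g₂ +_) (sym (hor≡boxSum a b g₁)) ⟩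
      hor a b g₂ + hor a b g₁
        ≡⟨ +-comm (hor a b g₂) (hor a b g₁) ⟩
      hor a b g₁ + hor a b g₂ ∎
      where
      pointwise : ∀ {i j} → InBox a b i j → indicator right (get g i j)
                  ≡ indicator right (get g₂ i j) + indicator left (get g₁ (reflect a i) (reflect b j))
      pointwise {i} {j} c with T? (Y₂ A i j)
      ... | yes y₂ rewrite glue-in c y₂ | rotated-vacant c y₂ = sym (+-identityʳ _)
      ... | no ∉Y₂ rewrite glue-out c ∉Y₂ | vacant⇒none a b t₂ c ∉Y₂ = indicator-opp _

  Decomposition : Set
  Decomposition = List Bool × Grid × Grid

  decompositions : List Decomposition
  decompositions = cartesianProduct (subsets b) (cartesianProduct (allGrids a b) (allGrids a b))

  IsDecomposition : Decomposition → Set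
  IsDecomposition (A , g₁ , g₂) = IsSubset b A × IsGrid a b g₁ × IsGrid a b g₂

  decompositions-enumeration : Enumeration IsDecomposition decompositions
  decompositions-enumeration = enumeration-cartesianProduct (subsets-enumeration b)
    (enumeration-cartesianProduct (grids-enumeration a b) (grids-enumeration a b))

  _≟ᴰᶜ_ : DecidableEquality Decomposition
  _≟ᴰᶜ_ = ×-≡-dec (≡-dec Bool._≟_) (×-≡-dec _≟ᴳ_ _≟ᴳ_)

  productWeight : Decomposition → 𝔾
  productWeight (A , g₁ , g₂) = weight a b (Y₁ A) g₁ ⊗ weight a b (Y₂ A) g₂

  bothTile : Decomposition → Bool
  bothTile (A , g₁ , g₂) = isTiling a b (Y₁ A) g₁ ∧ isTiling a b (Y₂ A) g₂

  productWeight-outside : ∀ y → ¬ T (bothTile y) → productWeight y ≡ 0𝔾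
  productWeight-outside (A , g₁ , g₂) ¬both with T? (isTiling a b (Y₁ A) g₁)
  ... | no ¬t₁ = trans (cong (_⊗ weight a b (Y₂ A) g₂) (weight-outside a b (Y₁ A) g₁ ¬t₁))
                       (⊗-zeroˡ (weight a b (Y₂ A) g₂))
  ... | yes t₁ = trans (cong (weight a b (Y₁ A) g₁ ⊗_) (weight-outside a b (Y₂ A) g₂ (¬both ∘ ∧-join t₁)))
                       (⊗-zeroʳ (weight a b (Y₁ A) g₁))

  tiles₁ : ∀ {A g₁ g₂} → T (bothTile (A , g₁ , g₂)) → Tiles a b (Y₁ A) (get g₁)
  tiles₁ both = isTiling⇒Tiles (proj₁ (∧-split both))

  tiles₂ : ∀ {A g₁ g₂} → T (bothTile (A , g₁ , g₂)) → Tiles a b (Y₂ A) (get g₂)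
  tiles₂ both = isTiling⇒Tiles (proj₂ (∧-split both))

  split-glue : ∀ y → IsDecomposition y → T (bothTile y) → split (glue y) ≡ y
  split-glue (A , g₁ , g₂) (isSubset , isGrid₁ , isGrid₂) both =
    cong₂ _,_ (diagonalSubset-glue isSubset)
              (cong₂ _,_ (upperGrid-glue isSubset isGrid₁) (lowerGrid-glue isSubset isGrid₂))
    where open Glue A g₁ g₂ (tiles₁ both) (tiles₂ both)

  weight-glue : ∀ y → IsDecomposition y → T (bothTile y) → weight a b R (glue y) ≡ productWeight y
  weight-glue (A , g₁ , g₂) _ both = begin
    weight a b R (glue (A , g₁ , g₂))  ≡⟨ weight-inside a b R _ (Tiles⇒isTiling Tiles-glue) ⟩
    ι^ (hor a b (glue (A , g₁ , g₂)))  ≡⟨ cong ι^ hor-glue ⟩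
    ι^ (hor a b g₁ + hor a b g₂)       ≡⟨ ι^-+ (hor a b g₁) (hor a b g₂) ⟩
    ι^ (hor a b g₁) ⊗ ι^ (hor a b g₂)  ≡⟨ sym (cong₂ _⊗_ (weight-inside a b (Y₁ A) g₁ (proj₁ (∧-split both)))
                                                         (weight-inside a b (Y₂ A) g₂ (proj₂ (∧-split both)))) ⟩
    productWeight (A , g₁ , g₂)        ∎
    where open Glue A g₁ g₂ (tiles₁ both) (tiles₂ both)

  decomposition : SupportBijection (IsGrid a b) IsDecomposition (weight a b R) productWeight
  decomposition = record
    { to         = split
    ; from       = glue
    ; suppˣ      = isTiling a b R
    ; suppʸ      = bothTile
    ; f-outside  = weight-outside a b R
    ; g-outside  = productWeight-outside
    ; to-shape   = λ g _ _ → ListOf-tabulate₁ b (λ j → backward (get g (h ∸ j) j)) ,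
                             IsGrid-tabulateGrid a b (rotatePairing a b (restrict (R ∖ lowerRegion g) (get g))) ,
                             IsGrid-tabulateGrid a b (restrict (lowerRegion g) (get g))
    ; to-supp    = λ g _ t → let open Split g (isTiling⇒Tiles t) in
                     ∧-join (Tiles⇒isTiling {X = Y₁ (diagonalSubset g)} Tiles-upperGrid)
                            (Tiles⇒isTiling {X = Y₂ (diagonalSubset g)} Tiles-lowerGrid)
    ; from-to    = λ g isGrid t → Split.glue-split g (isTiling⇒Tiles t) isGrid
    ; from-shape = λ (A , g₁ , g₂) _ _ → IsGrid-tabulateGrid a b (merge (Y₂ A) (get g₂) (rotatePairing a b (get g₁)))
    ; from-supp  = λ (A , g₁ , g₂) _ both → Tiles⇒isTiling (Glue.Tiles-glue A g₁ g₂ (tiles₁ both) (tiles₂ both))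
    ; to-from    = split-glue
    ; f-from     = weight-glue
    }

  factorisation : S a b R ≡ ∑ (subsets b) (λ A → S a b (Y₁ A) ⊗ S a b (Y₂ A))
  factorisation = begin
    ∑ (allGrids a b) (weight a b R)
      ≡⟨ ∑-reindex _≟ᴳ_ _≟ᴰᶜ_ (grids-enumeration a b) decompositions-enumeration decomposition ⟩
    ∑ decompositions productWeight
      ≡⟨ ∑-cartesianProductWith _,_ (subsets b) _ productWeight ⟩
    ∑ (subsets b) (λ A → ∑ (cartesianProduct (allGrids a b) (allGrids a b))
                         (λ (g₁ , g₂) → productWeight (A , g₁ , g₂)))
      ≡⟨ ∑-cong (subsets b) (λ A → trans (∑-cartesianProductWith _,_ (allGrids a b) (allGrids a b) _)
                                        (sym (∑-product (allGrids a b) (allGrids a b) _ _))) ⟩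
    ∑ (subsets b) (λ A → S a b (Y₁ A) ⊗ S a b (Y₂ A)) ∎

odd+odd≡double : ∀ {m n} → Odd m → Odd n → m + n ≡ ⌊ m + n /2⌋ + ⌊ m + n /2⌋
odd+odd≡double {m} {n} odd-m odd-n = begin
  m + n                           ≡⟨ m+n≡k+k ⟩
  k + k                           ≡⟨ cong₂ _+_ (n≡⌊n+n/2⌋ k) (n≡⌊n+n/2⌋ k) ⟩
  ⌊ k + k /2⌋ + ⌊ k + k /2⌋       ≡⟨ cong (λ x → ⌊ x /2⌋ + ⌊ x /2⌋) (sym m+n≡k+k) ⟩
  ⌊ m + n /2⌋ + ⌊ m + n /2⌋       ∎
  where
  k : ℕ
  k = suc (m / 2 + n / 2)
  m+n≡k+k : m + n ≡ k + k
  m+n≡k+k = begin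
    m + n                                   ≡⟨ cong₂ _+_ (m≡m%n+[m/n]*n m 2) (m≡m%n+[m/n]*n n 2) ⟩
    (m % 2 + m / 2 * 2) + (n % 2 + n / 2 * 2) ≡⟨ cong₂ (λ r s → (r + m / 2 * 2) + (s + n / 2 * 2)) odd-m odd-n ⟩
    (1 + m / 2 * 2) + (1 + n / 2 * 2)       ≡⟨ regroup (m / 2) (n / 2) ⟩
    k + k                                   ∎
    where
    open ℕ.+-*-Solver
    regroup : ∀ p q → (1 + p * 2) + (1 + q * 2) ≡ suc (p + q) + suc (p + q)
    regroup = solve 2 (λ p q → (con 1 :+ p :* con 2) :+ (con 1 :+ q :* con 2)
                              := (con 1 :+ (p :+ q)) :+ (con 1 :+ (p :+ q))) refl

proposition4p9 : (m n : ℕ) → Odd m → Odd n → n < m →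
    S (m ∸ 1) (n ∸ 1) (Rect (m ∸ 1) (n ∸ 1))
      ≡ sum𝔾 (map (λ A → S (m ∸ 1) (n ∸ 1) (YB m n (reflCompl n A)) *𝔾 S (m ∸ 1) (n ∸ 1) (YB m n (memb A))) (subsets (n ∸ 1)))
proposition4p9 zero    n       ()    _     _
proposition4p9 (suc a) zero    _     ()    _
proposition4p9 (suc a) (suc b) odd-m odd-n (s≤s b<a) =
  Staircase.factorisation a b ⌊ suc a + suc b /2⌋ (odd+odd≡double {suc a} {suc b} odd-m odd-n) b<a
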